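{- Let $\mathcal{O}=\{O_1,\dots,O_n\}$ be a family of cycles in $K_{n+1}$ without any rainbow cycle, and let $\mathcal{K}=\{O_1,\dots,O_k\}$ with $k<n$. Suppose $Q$ is a subgraph of $\bigcup\mathcal{K}$ with exactly $k+1$ vertices, and $V\subseteq V(Q)$ is such that every pair of vertices in $V$ can be connected by a $\mathcal{K}$-rainbow path of length at least $2$ in $Q$. Then: (a) No edge of $O_{k+1},\dots,O_n$ has both endpoints in $V$. Moreover, let $\pi$ be the contraction that replaces $V(Q)$ by a single vertex $\bar v$ (removing all edges between contracted vertices), and let $P_{k+1},\dots,P_n$ be subgraphs of $O_{k+1},\dots,O_n$ respectively such that each $P_i$ avoids all vertices of $V(Q)\setminus V$. Let $\bar{\mathcal{P}}=\{\pi(P_{k+1}),\dots,\pi(P_n)\}$. Then: (b) There is no $\bar{\mathcal{P}}$-rainbow cycle in $\pi(K_{n+1})$. (c) If $\bar{\mathcal{P}}$ is a saguaro of cycles, then $\bigcup\bar{\mathcal{P}}$ is spanning in $\pi(K_{n+1})$; moreover, for every $i\in\{k+1,\dots,n\}$ such that $\pi(P_i)$ is common in $\bar{\mathcal{P}}$, $O_i\setminus P_i$ contains no edge $uv$ with $u\notin V(Q)\cup V(P_i)$ and $v\in V\cap V(P_i)$.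
   Context: Cycles, paths and subgraphs are regarded as edge sets; $V(\cdot)$ is the vertex set spanned, $\bigcup\mathcal{K}$ the union. A family means a multiset. Given a family $\mathcal{E}$ of edge sets, an $\mathcal{E}$-rainbow set is a set $R\subseteq\bigcup\mathcal{E}$ with an injection $\sigma:R\to\mathcal{E}$ such that $e\in\sigma(e)$ for all $e\in R$. An $\ell$-cycle is common in a family if it appears in the family exactly $\ell-1$ times. Pruned cactus: a family $\mathcal{O}$ of cycles is a pruned cactus if either all cycles in $\mathcal{O}$ are identical to one cycle on $|\mathcal{O}|+1$ vertices, or $\mathcal{O}$ can be partitioned into two pruned cacti $\mathcal{O}_1,\mathcal{O}_2$ such that $\bigcup\mathcal{O}_1$ and $\bigcup\mathcal{O}_2$ share exactly one vertex. Saguaro: a family of cycles is a saguaro if it is a pruned cactus, or it can be partitioned into three subfamilies $\mathcal{O}_1,\{O\},\mathcal{O}_2$ with $\mathcal{O}_1,\mathcal{O}_2$ vertex-disjoint saguaros and $O$ an even cycle whose vertices alternate, along $O$, between $V(\bigcup\mathcal{O}_1)$ and $V(\bigcup\mathcal{O}_2)$. -}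

module Defs where

open import Data.Nat using (ℕ; zero; suc; _+_; _*_)
open import Data.Fin using (Fin; zero; suc; inject₁; fromℕ)
open import Data.Product using (Σ; ∃; _×_; _,_)
open import Data.Sum using (_⊎_)
open import Data.List using (List; length)
open import Data.Empty using (⊥)
open import Data.List.Relation.Unary.All using (All)
open import Data.List.Relation.Binary.Permutation.Propositional using (_↭_)
open import Data.List using (_++_; _∷_; [])
open import Relation.Binary.PropositionalEquality using (_≡_; _≢_)
open import Relation.Nullary using (¬_)
open import Function.Definitions using (Injective)

-- Edge sets on a vertex type A.  An edge set is a relation; the edge
-- {u,v} belongs to E iff  Adj E u v  (symmetric closure, no loops).

EdgeSet : Set → Set₁
EdgeSet A = A → A → Set

Adj : {A : Set} → EdgeSet A → A → A → Set
Adj E u v = u ≢ v × (E u v ⊎ E v u)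

_⊆ₑ_ : {A : Set} → EdgeSet A → EdgeSet A → Set
E ⊆ₑ F = ∀ u v → Adj E u v → Adj F u v

VS : {A : Set} → EdgeSet A → A → Set
VS E u = ∃ λ v → Adj E u v

⋃F : {A : Set} {r : ℕ} → (Fin r → EdgeSet A) → EdgeSet A
⋃F F u v = ∃ λ i → Adj (F i) u v

⋃L : {A : Set} → List (EdgeSet A) → EdgeSet A
⋃L [] u v = ⊥
⋃L (E ∷ O) u v = Adj E u v ⊎ ⋃L O u v

-- Cycles.  A cyclic vertex sequence of ℓ = 3 + len distinct vertices;
-- csuc is the cyclic successor on positions.

csuc : ∀ {ℓ} → Fin (suc ℓ) → Fin (suc ℓ)
csuc {zero} zero = zero
csuc {suc ℓ} zero = suc zero
csuc {suc ℓ} (suc i) with csuc {ℓ} i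
... | zero = zero
... | suc j = suc (suc j)

record Cyc (A : Set) : Set where
  field
    len : ℕ
    vs  : Fin (3 + len) → A
    inj : Injective _≡_ _≡_ vs
open Cyc public

nverts : {A : Set} → Cyc A → ℕ
nverts c = 3 + len c

CycEdge : {A : Set} → Cyc A → A → A → Set
CycEdge c u v = ∃ λ i → (vs c i ≡ u × vs c (csuc i) ≡ v) ⊎ (vs c i ≡ v × vs c (csuc i) ≡ u)

IsCycleOn : {A : Set} → EdgeSet A → Cyc A → Set
IsCycleOn E c = ∀ u v → (Adj E u v → CycEdge c u v) × (CycEdge c u v → Adj E u v)

IsCycle : {A : Set} → EdgeSet A → Set
IsCycle E = Σ (Cyc _) (IsCycleOn E)

-- Rainbow cycles and rainbow paths (rainbow set = edges with an
-- injective choice of family members containing them).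

RainbowCycle : {A : Set} {r : ℕ} → (Fin r → EdgeSet A) → Set
RainbowCycle {r = r} F =
  Σ (Cyc _) λ c → Σ (Fin (3 + len c) → Fin r) λ σ →
    Injective _≡_ _≡_ σ × (∀ i → Adj (F (σ i)) (vs c i) (vs c (csuc i)))

RainbowPathIn : {A : Set} {r : ℕ} → (Fin r → EdgeSet A) → EdgeSet A → ℕ → A → A → Set
RainbowPathIn {A} {r} F H ℓ u v =
  Σ (Fin (suc ℓ) → A) λ w → Injective _≡_ _≡_ w × w zero ≡ u × w (fromℕ ℓ) ≡ v ×
    Σ (Fin ℓ → Fin r) λ σ → Injective _≡_ _≡_ σ ×
      (∀ j → Adj H (w (inject₁ j)) (w (suc j)) × Adj (F (σ j)) (w (inject₁ j)) (w (suc j)))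

-- Pruned cacti and saguaros (families = lists up to permutation)

ShareExactlyOne : {A : Set} → EdgeSet A → EdgeSet A → Set
ShareExactlyOne U₁ U₂ = ∃ λ x → VS U₁ x × VS U₂ x × (∀ y → VS U₁ y → VS U₂ y → y ≡ x)

data PrunedCactus {A : Set} : List (EdgeSet A) → Set₁ where
  identical : ∀ {O} (c : Cyc A) → All (λ E → IsCycleOn E c) O →
              nverts c ≡ suc (length O) → PrunedCactus O
  glue : ∀ {O O₁ O₂} → O ↭ O₁ ++ O₂ → PrunedCactus O₁ → PrunedCactus O₂ →
         ShareExactlyOne (⋃L O₁) (⋃L O₂) → PrunedCactus O

data Saguaro {A : Set} : List (EdgeSet A) → Set₁ where
  cactus : ∀ {O} → PrunedCactus O → Saguaro O
  join : ∀ {O O₁ O₂} {E : EdgeSet A} → O ↭ O₁ ++ (E ∷ O₂) →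
         Saguaro O₁ → Saguaro O₂ →
         (∀ x → VS (⋃L O₁) x → ¬ VS (⋃L O₂) x) →
         (c : Cyc A) → IsCycleOn E c → (∃ λ h → nverts c ≡ 2 * h) →
         (∀ i → (VS (⋃L O₁) (vs c i) × VS (⋃L O₂) (vs c (csuc i)))
              ⊎ (VS (⋃L O₂) (vs c i) × VS (⋃L O₁) (vs c (csuc i)))) →
         Saguaro O

-- F i is common in the family F: it is an ℓ-cycle appearing exactly
-- ℓ - 1 times in F (counted with multiplicity, i.e. over indices j).

Common : {A : Set} {r : ℕ} → (Fin r → EdgeSet A) → Fin r → Set
Common {r = r} F i =
  Σ (Cyc _) λ c → IsCycleOn (F i) c ×
    Σ (Fin (2 + len c) → Fin r) λ g → Injective _≡_ _≡_ g ×
      (∀ j → (IsCycleOn (F j) c → ∃ λ t → g t ≡ j) × ((∃ λ t → g t ≡ j) → IsCycleOn (F j) c))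

-- Contraction of the vertex set V(Q) to the single vertex c̄
-- (c̄ a chosen vertex of V(Q), which represents the new vertex v̄).
-- Vertex u of the original graph becomes x.

ContrV : {A : Set} → EdgeSet A → A → A → A → Set
ContrV Q c̄ u x = (VS Q u × x ≡ c̄) ⊎ (¬ VS Q u × x ≡ u)

-- π(E); edges between contracted vertices disappear (x ≢ y)
Contr : {A : Set} → EdgeSet A → A → EdgeSet A → EdgeSet A
Contr Q c̄ E x y = x ≢ y × ∃ λ u → ∃ λ v → Adj E u v × ContrV Q c̄ u x × ContrV Q c̄ v y

ContrVertex : {A : Set} → EdgeSet A → A → A → Set
ContrVertex Q c̄ x = x ≡ c̄ ⊎ ¬ VS Q x

-- Write v̄ for the vertex c̄ that represents the contracted set V(Q).
-- (a) An edge of some O_i (i > k) joining two vertices of V closes a K-rainbow path of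
-- length at least 2 inside Q into a rainbow cycle of O.
-- (b) A rainbow cycle of the contracted family either avoids v̄, and is then a rainbow
-- cycle of the O_i themselves, or passes through v̄.  Its two edges at v̄ then come from
-- edges of the P_i ending in vertices of V, and a K-rainbow path inside Q between those
-- two vertices (nothing, if they coincide) reopens it into a rainbow cycle of O.
-- (c) Every saguaro spans at least one vertex more than it has cycles, and any two of its
-- vertices are joined by a rainbow path of length at least 2.  As π(K_{n+1}) has only
-- n - k + 1 vertices, the saguaro spans it.  If O_i ∖ P_i contained an edge uv as
-- excluded, follow a rainbow path of the saguaro from u to v̄ until it first meets the
-- common cycle π(P_i), continue around that cycle to v̄ using the other copies of it, and
-- close with π(uv): this is a rainbow cycle of the family with uv added to P_i, which (b)
-- rules out.

module Submission where

open import Defs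
open import Data.Nat using (ℕ; zero; suc; _+_; _∸_; _<_; _≤_; z≤n; s≤s)
open import Data.Nat.Properties
  using ( _≤?_; ≤-refl; ≤-reflexive; ≤-trans; ≤-antisym; ≤-pred; n≤1+n; <-irrefl; <⇒≤; <⇒≢; ≰⇒>
        ; +-comm; +-assoc; +-suc; suc-injective; +-mono-≤; +-monoˡ-<; +-cancelʳ-≤; +-cancelʳ-<; m<n+m
        ; m∸n+n≡m; m+[n∸m]≡n; m∸n≤m; m<n⇒0<n∸m; m≤n⇒m⊓n≡m; module ≤-Reasoning )
import Data.Fin
open import Data.Fin using (Fin; zero; suc; inject₁; fromℕ; toℕ; _↑ˡ_; _↑ʳ_; splitAt; punchIn)
open import Data.Fin.Properties
  using ( fromℕ≢inject₁; inject₁-injective; toℕ-injective; toℕ<n; toℕ-fromℕ; toℕ-inject₁; pigeonhole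
        ; punchIn-injective; punchInᵢ≢i; splitAt-↑ˡ; splitAt-↑ʳ; ↑ˡ-injective; ↑ʳ-injective )
open import Data.Product using (Σ; ∃; ∃₂; _×_; _,_; proj₁; proj₂)
open import Data.Sum using (_⊎_; inj₁; inj₂; [_,_]′)
open import Data.List
  using (List; []; _∷_; _++_; [_]; length; tabulate; map; lookup; applyUpTo; filter; take; drop; allFin)
open import Data.List.Properties
  using ( length-tabulate; length-++; length-take; length-applyUpTo; length-map; ++-assoc; ++-identityʳ
        ; tabulate-lookup; map-tabulate; filter-all; take++drop≡id; ∷-injective )
open import Data.List.Membership.Propositional using (_∈_; _∉_)
open import Data.List.Membership.Propositional.Properties
  using (∈-tabulate⁺; ∈-tabulate⁻; ∈-++⁺ˡ; ∈-++⁺ʳ; ∈-++⁻; ∈-lookup; ∈-filter⁻; ∈-applyUpTo⁻; ∈-map⁻)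
open import Data.List.Relation.Unary.Any using (here; there)
open import Data.List.Relation.Unary.All as All using (All; []; _∷_)
import Data.List.Relation.Unary.All.Properties as All
open import Data.List.Relation.Unary.AllPairs using ([]; _∷_)
open import Data.List.Relation.Unary.Unique.Propositional using (Unique)
open import Data.List.Relation.Unary.Unique.Propositional.Properties
  using (Unique[x∷xs]⇒x∉xs; applyUpTo⁺₁; ++⁺; map⁺; allFin⁺)
  renaming (tabulate⁺ to Unique-tabulate⁺; filter⁺ to Unique-filter⁺; take⁺ to Unique-take⁺)
open import Data.List.Relation.Binary.Permutation.Propositional
  using (_↭_; ↭-refl; ↭-sym; ↭-trans; ↭-prep; ↭-reflexive; ↭⇒↭ₛ; module PermutationReasoning)
open import Data.List.Relation.Binary.Permutation.Propositional.Properties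
  using (shift; shifts; ∷↭∷ʳ; ∈-resp-↭; ↭-length; All-resp-↭; ↭-map-inv)
  renaming (++⁺ to ↭-++⁺; ++⁺ˡ to ↭-++⁺ˡ; ++⁺ʳ to ↭-++⁺ʳ)
import Data.List.Relation.Binary.Permutation.Setoid.Properties as PermutationSetoid
open import Data.Empty using (⊥; ⊥-elim)
open import Level using (Level)
open import Relation.Binary.PropositionalEquality
  using (_≡_; _≢_; refl; sym; trans; cong; cong₂; subst; subst₂; setoid; module ≡-Reasoning)
open import Relation.Nullary using (¬_; yes; no; ¬?)
open import Relation.Binary.Definitions using (DecidableEquality)
open import Data.Vec.Functional using () renaming (_++_ to _++ᶠ_)
open import Data.Vec.Functional.Properties using (lookup-++ˡ; lookup-++ʳ)
open import Function using (_∘_; id; case_of_)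
open import Function.Definitions using (Injective)

private
  variable
    a : Level
    A : Set
    X : Set a

Adj-sym : {E : EdgeSet A} {x y : A} → Adj E x y → Adj E y x
Adj-sym (x≢y , inj₁ e) = (λ y≡x → x≢y (sym y≡x)) , inj₂ e
Adj-sym (x≢y , inj₂ e) = (λ y≡x → x≢y (sym y≡x)) , inj₁ e

csuc-inject₁ : ∀ {ℓ} (j : Fin ℓ) → csuc (inject₁ j) ≡ suc j
csuc-inject₁ {suc ℓ} zero = refl
csuc-inject₁ {suc ℓ} (suc j) with csuc (inject₁ j) | csuc-inject₁ j
... | .(suc j) | refl = refl

csuc-fromℕ : ∀ ℓ → csuc (fromℕ ℓ) ≡ zero
csuc-fromℕ zero = refl
csuc-fromℕ (suc ℓ) with csuc (fromℕ ℓ) | csuc-fromℕ ℓ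
... | .zero | refl = refl

data LastView : ∀ {m} → Fin (suc m) → Set where
  last  : ∀ {m} → LastView (fromℕ m)
  inject : ∀ {m} (j : Fin m) → LastView (inject₁ j)

lastView : ∀ {m} (i : Fin (suc m)) → LastView i
lastView {zero} zero = last
lastView {suc m} zero = inject zero
lastView {suc m} (suc i) with lastView i
... | last = last
... | inject j = inject (suc j)

Unique-resp-↭ : {xs ys : List X} → xs ↭ ys → Unique xs → Unique ys
Unique-resp-↭ {X = X} p = PermutationSetoid.Unique-resp-↭ (setoid X) (↭⇒↭ₛ p)

Unique-++⁻ˡ : (xs : List X) {ys : List X} → Unique (xs ++ ys) → Unique xs
Unique-++⁻ˡ [] _ = []
Unique-++⁻ˡ (x ∷ xs) (x∉ ∷ u) = All.tabulate (λ z∈ → All.lookup x∉ (∈-++⁺ˡ z∈)) ∷ Unique-++⁻ˡ xs u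

length-++-≥ : ∀ {m n} (xs : List X) {ys} → m ≤ length xs → n ≤ length ys → m + n ≤ length (xs ++ ys)
length-++-≥ xs m≤ n≤ = subst (_ ≤_) (sym (length-++ xs)) (+-mono-≤ m≤ n≤)

map-++⁻ : ∀ {b} {Y : Set b} (f : X → Y) xs (ys : List Y) {zs} → map f xs ≡ ys ++ zs →
          ∃₂ λ xs₁ xs₂ → xs ≡ xs₁ ++ xs₂ × map f xs₁ ≡ ys
map-++⁻ f xs [] _ = [] , xs , refl , refl
map-++⁻ f (x ∷ xs) (y ∷ ys) e with xs₁ , xs₂ , refl , refl ← map-++⁻ f xs ys (proj₂ (∷-injective e)) =
  x ∷ xs₁ , xs₂ , refl , cong (_∷ map f xs₁) (proj₁ (∷-injective e))

All-≢-sym : ∀ {x : X} {xs} → All (x ≢_) xs → All (_≢ x) xs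
All-≢-sym = All.map (λ x≢z z≡x → x≢z (sym z≡x))

Unique-tabulate⁻ : ∀ {n} (f : Fin n → X) → Unique (tabulate f) → Injective _≡_ _≡_ f
Unique-tabulate⁻ f u {zero} {zero} _ = refl
Unique-tabulate⁻ f u {zero} {suc j} e =
  ⊥-elim (Unique[x∷xs]⇒x∉xs u (subst (_∈ tabulate (λ i → f (suc i))) (sym e) (∈-tabulate⁺ j)))
Unique-tabulate⁻ f u {suc i} {zero} e =
  ⊥-elim (Unique[x∷xs]⇒x∉xs u (subst (_∈ tabulate (λ i → f (suc i))) e (∈-tabulate⁺ i)))
Unique-tabulate⁻ f (_ ∷ u) {suc i} {suc j} e = cong suc (Unique-tabulate⁻ (λ i → f (suc i)) u e)

module _ {ℓc} {C : Set ℓc} (F : C → EdgeSet A) where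

  data Walk : A → A → List A → List C → Set ℓc where
    stop : ∀ {x} → Walk x x [] []
    step : ∀ {x y z ts cs} (c : C) → Adj (F c) x y → Walk y z ts cs → Walk x z (y ∷ ts) (c ∷ cs)

  record RainbowClosedWalk : Set ℓc where
    field
      start end         : A
      inner             : List A
      colours           : List C
      closer            : C
      walk              : Walk start end inner colours
      distinct-vertices : Unique (start ∷ inner)
      distinct-colours  : Unique (closer ∷ colours)
      closing-edge      : Adj (F closer) end start
      long              : 2 ≤ length inner

module _ {ℓc} {C : Set ℓc} {F : C → EdgeSet A} where

  infixr 5 _++ᵂ_
  _++ᵂ_ : ∀ {x y z ts cs ts′ cs′} → Walk F x y ts cs → Walk F y z ts′ cs′ → Walk F x z (ts ++ ts′) (cs ++ cs′)
  stop ++ᵂ q = q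
  step c e p ++ᵂ q = step c e (p ++ᵂ q)

  end∈ : ∀ {x y ts cs} → Walk F x y ts cs → 1 ≤ length ts → y ∈ ts
  end∈ (step c e stop) _ = here refl
  end∈ (step c e (step c′ e′ p)) _ = there (end∈ (step c′ e′ p) (s≤s z≤n))

  no-return : ∀ {x ts cs} → Walk F x x ts cs → 1 ≤ length ts → ¬ Unique (x ∷ ts)
  no-return p nonempty distinct = Unique[x∷xs]⇒x∉xs distinct (end∈ p nonempty)

  private
    reverseOnto : ∀ {x y s ts cs us ds} → Walk F x y ts cs → Walk F x s us ds →
                  ∃₂ λ ts′ cs′ → Walk F y s ts′ cs′ × (y ∷ ts′) ↭ (ts ++ x ∷ us) × cs′ ↭ (cs ++ ds)
    reverseOnto stop acc = _ , _ , acc , ↭-refl , ↭-refl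
    reverseOnto {x = x} {us = us} {ds} (step {y = x′} {ts = ts} {cs = cs} c e p) acc
      with ts′ , cs′ , q , vp , cp ← reverseOnto p (step c (Adj-sym {E = F c} e) acc) =
      ts′ , cs′ , q , ↭-trans vp (shift x′ ts (x ∷ us)) , ↭-trans cp (shift c cs ds)

  reverseᵂ : ∀ {x y ts cs} → Walk F x y ts cs →
             ∃₂ λ ts′ cs′ → Walk F y x ts′ cs′ × (y ∷ ts′) ↭ (x ∷ ts) × cs′ ↭ cs
  reverseᵂ {x} {ts = ts} {cs} p with ts′ , cs′ , q , vp , cp ← reverseOnto p stop =
    ts′ , cs′ , q , ↭-trans vp (↭-trans (shift x ts []) (↭-prep x (↭-reflexive (++-identityʳ ts)))) ,
    subst (cs′ ↭_) (++-identityʳ cs) cp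

mapᵂ : ∀ {ℓc ℓd} {C : Set ℓc} {D : Set ℓd} {F : C → EdgeSet A} {G : D → EdgeSet A}
       (h : C → D) → (∀ c {x y} → Adj (F c) x y → Adj (G (h c)) x y) →
       ∀ {x y ts cs} → Walk F x y ts cs → Walk G x y ts (map h cs)
mapᵂ h h-edge stop = stop
mapᵂ h h-edge (step c e p) = step (h c) (h-edge c e) (mapᵂ h h-edge p)

comapᵂ : ∀ {ℓc ℓd} {C : Set ℓc} {D : Set ℓd} {F : D → EdgeSet A} (h : C → D) {x y ts} (cs : List C) →
         Walk F x y ts (map h cs) → Walk (F ∘ h) x y ts cs
comapᵂ h [] stop = stop
comapᵂ h (c ∷ cs) (step .(h c) e p) = step c e (comapᵂ h cs p)

module _ {ℓc} {C : Set ℓc} {F : C → EdgeSet A} where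

  tabulateᵂ : ∀ {m} (w : Fin (suc m) → A) (σ : Fin m → C) →
              (∀ j → Adj (F (σ j)) (w (inject₁ j)) (w (suc j))) →
              Walk F (w zero) (w (fromℕ m)) (tabulate (λ i → w (suc i))) (tabulate σ)
  tabulateᵂ {zero} w σ edge = stop
  tabulateᵂ {suc m} w σ edge =
    step (σ zero) (edge zero) (tabulateᵂ (λ i → w (suc i)) (λ j → σ (suc j)) (λ j → edge (suc j)))

  vertexAt : ∀ {x y ts cs} → Walk F x y ts cs → Fin (suc (length cs)) → A
  vertexAt {x} _ zero = x
  vertexAt (step c e p) (suc i) = vertexAt p i

  tabulate-vertexAt : ∀ {x y ts cs} (p : Walk F x y ts cs) → tabulate (vertexAt p) ≡ x ∷ ts
  tabulate-vertexAt stop = refl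
  tabulate-vertexAt {x} (step c e p) = cong (x ∷_) (tabulate-vertexAt p)

  vertexAt-last : ∀ {x y ts cs} (p : Walk F x y ts cs) → vertexAt p (fromℕ (length cs)) ≡ y
  vertexAt-last stop = refl
  vertexAt-last (step c e p) = vertexAt-last p

  vertexAt-edge : ∀ {x y ts cs} (p : Walk F x y ts cs) (j : Fin (length cs)) →
                  Adj (F (lookup cs j)) (vertexAt p (inject₁ j)) (vertexAt p (suc j))
  vertexAt-edge (step c e stop) zero = e
  vertexAt-edge (step c e (step c′ e′ p)) zero = e
  vertexAt-edge (step c e p) (suc j) = vertexAt-edge p j

module _ {r} {F : Fin r → EdgeSet A} where

  private
    withLast : ∀ {m} → (Fin m → Fin r) → Fin r → Fin (suc m) → Fin r
    withLast σ c i with lastView i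
    ... | last = c
    ... | inject j = σ j

    withLast-injective : ∀ {m} (σ : Fin m → Fin r) c → Injective _≡_ _≡_ σ → (∀ j → σ j ≢ c) →
                         Injective _≡_ _≡_ (withLast σ c)
    withLast-injective σ c σ-inj σ≢c {i} {i′} e with lastView i | lastView i′
    ... | last     | last      = refl
    ... | last     | inject j  = ⊥-elim (σ≢c j (sym e))
    ... | inject j | last      = ⊥-elim (σ≢c j e)
    ... | inject j | inject j′ = cong inject₁ (σ-inj e)

    closeWalk : ∀ {x y ts cs} (c : Fin r) → Walk F x y ts cs → 2 ≤ length ts →
                Unique (x ∷ ts) → Unique (c ∷ cs) → Adj (F c) y x → RainbowCycle F
    closeWalk c stop ()
    closeWalk c (step _ _ stop) (s≤s ())
    closeWalk {cs = cs} c p@(step _ _ (step _ _ _)) _ distinct-vertices (c∉cs ∷ distinct-cs) closing =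
      record { len = _ ; vs = vertexAt p ; inj = vertexAt-injective } ,
      withLast (lookup cs) c , withLast-injective (lookup cs) c lookup-injective lookup≢c , edge
      where
        vertexAt-injective : Injective _≡_ _≡_ (vertexAt p)
        vertexAt-injective = Unique-tabulate⁻ _ (subst Unique (sym (tabulate-vertexAt p)) distinct-vertices)
        lookup-injective : Injective _≡_ _≡_ (lookup cs)
        lookup-injective = Unique-tabulate⁻ _ (subst Unique (sym (tabulate-lookup cs)) distinct-cs)
        lookup≢c : ∀ j → lookup cs j ≢ c
        lookup≢c j e = All.lookup c∉cs (∈-lookup j) (sym e)
        edge : ∀ i → Adj (F (withLast (lookup cs) c i)) (vertexAt p i) (vertexAt p (csuc i))
        edge i with lastView i
        ... | last = subst₂ (Adj (F c)) (sym (vertexAt-last p)) (cong (vertexAt p) (sym (csuc-fromℕ _))) closing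
        ... | inject j = subst (λ z → Adj (F (lookup cs j)) (vertexAt p (inject₁ j)) (vertexAt p z))
                               (sym (csuc-inject₁ j)) (vertexAt-edge p j)

  closedWalk⇒rainbowCycle : RainbowClosedWalk F → RainbowCycle F
  closedWalk⇒rainbowCycle C = closeWalk closer walk long distinct-vertices distinct-colours closing-edge
    where open RainbowClosedWalk C

  rainbowCycle⇒closedWalk : RainbowCycle F → RainbowClosedWalk F
  rainbowCycle⇒closedWalk (cy , σ , σ-inj , edge) = record
    { walk              = tabulateᵂ w (λ j → σ (inject₁ j)) inner-edge
    ; distinct-vertices = Unique-tabulate⁺ (inj cy)
    ; distinct-colours  = All.tabulate⁺ {f = λ j → σ (inject₁ j)} (λ j e → fromℕ≢inject₁ (σ-inj e))
                          ∷ Unique-tabulate⁺ (λ e → inject₁-injective (σ-inj e))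
    ; closing-edge      = subst (λ z → Adj (F (σ (fromℕ _))) (w (fromℕ _)) (w z)) (csuc-fromℕ _) (edge (fromℕ _))
    ; long              = subst (2 ≤_) (sym (length-tabulate (λ i → w (suc i)))) (s≤s (s≤s z≤n))
    }
    where
      w = vs cy
      inner-edge : ∀ j → Adj (F (σ (inject₁ j))) (w (inject₁ j)) (w (suc j))
      inner-edge j = subst (λ z → Adj (F (σ (inject₁ j))) (w (inject₁ j)) (w z)) (csuc-inject₁ j) (edge (inject₁ j))

module _ {ℓc} {C : Set ℓc} {F : C → EdgeSet A} where
  open RainbowClosedWalk

  vertices : RainbowClosedWalk F → List A
  vertices W = start W ∷ inner W

  rotate : (W : RainbowClosedWalk F) → ∀ {t : A} {ts} → inner W ≡ t ∷ ts →
           Σ (RainbowClosedWalk F) λ W′ → vertices W′ ≡ t ∷ ts ++ [ start W ]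
  rotate record { start = x ; walk = step {ts = ts} {cs} c e p ; distinct-vertices = dv ; distinct-colours = dc
                ; closer = c′ ; closing-edge = closing ; long = long } refl =
    record
      { walk              = p ++ᵂ step c′ closing stop
      ; distinct-vertices = Unique-resp-↭ (∷↭∷ʳ x _) dv
      ; distinct-colours  = Unique-resp-↭ (∷↭∷ʳ c′ _) dc
      ; closing-edge      = e
      ; long              = subst (2 ≤_) (sym (trans (length-++ ts) (+-comm (length ts) 1))) long
      } , refl

  private
    rotateAlong : ∀ {z} (W : RainbowClosedWalk F) {xs ys} → z ∈ xs → vertices W ≡ xs ++ ys →
                  Σ (RainbowClosedWalk F) λ W′ → start W′ ≡ z
    rotateAlong W (here refl) e = W , cong (λ { [] → start W ; (h ∷ _) → h }) e
    rotateAlong W {x ∷ x′ ∷ xs} {ys} (there z∈) e with rotate W (cong (λ { [] → [] ; (_ ∷ t) → t }) e)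
    ... | W′ , e′ = rotateAlong W′ z∈ (trans e′ (++-assoc (x′ ∷ xs) ys [ start W ]))

  rotateTo : ∀ {z} (W : RainbowClosedWalk F) → z ∈ vertices W →
             Σ (RainbowClosedWalk F) λ W′ → start W′ ≡ z
  rotateTo W z∈ = rotateAlong W z∈ (sym xs++[])
    where xs++[] = ++-identityʳ (vertices W)

module CyclicShift {m : ℕ} where

  csuc^ : ℕ → Fin (suc m) → Fin (suc m)
  csuc^ zero a = a
  csuc^ (suc t) a = csuc^ t (csuc a)

  csuc^-csuc : ∀ t a → csuc^ t (csuc a) ≡ csuc (csuc^ t a)
  csuc^-csuc zero a = refl
  csuc^-csuc (suc t) a = csuc^-csuc t (csuc a)

  csuc^-+ : ∀ s t a → csuc^ (s + t) a ≡ csuc^ s (csuc^ t a)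
  csuc^-+ zero t a = refl
  csuc^-+ (suc s) t a = trans (csuc^-+ s t (csuc a)) (cong (csuc^ s) (csuc^-csuc t a))

  toℕ-csuc : ∀ (i : Fin (suc m)) → toℕ i < m → toℕ (csuc i) ≡ suc (toℕ i)
  toℕ-csuc i i<m with lastView i
  ... | last = ⊥-elim (<-irrefl (toℕ-fromℕ m) i<m)
  ... | inject j = trans (cong toℕ (csuc-inject₁ j)) (cong suc (sym (toℕ-inject₁ j)))

  toℕ-csuc^-zero : ∀ t → t ≤ m → toℕ (csuc^ t zero) ≡ t
  toℕ-csuc^-zero zero _ = refl
  toℕ-csuc^-zero (suc t) t<m =
    trans (cong toℕ (csuc^-csuc t zero)) (trans (toℕ-csuc _ (subst (_< m) (sym ih) t<m)) (cong suc ih))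
    where ih = toℕ-csuc^-zero t (≤-trans (n≤1+n t) t<m)

  csuc^-toℕ : ∀ a → csuc^ (toℕ a) zero ≡ a
  csuc^-toℕ a = toℕ-injective (toℕ-csuc^-zero (toℕ a) (≤-pred (toℕ<n a)))

  csuc^-period : ∀ a → csuc^ (suc m) a ≡ a
  csuc^-period a = begin
    csuc^ (suc m) a                  ≡⟨ cong (csuc^ (suc m)) (sym (csuc^-toℕ a)) ⟩
    csuc^ (suc m) (csuc^ (toℕ a) zero) ≡⟨ sym (csuc^-+ (suc m) (toℕ a) zero) ⟩
    csuc^ (suc m + toℕ a) zero       ≡⟨ cong (λ t → csuc^ t zero) (+-comm (suc m) (toℕ a)) ⟩
    csuc^ (toℕ a + suc m) zero       ≡⟨ csuc^-+ (toℕ a) (suc m) zero ⟩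
    csuc^ (toℕ a) (csuc^ (suc m) zero) ≡⟨ cong (csuc^ (toℕ a)) period-zero ⟩
    csuc^ (toℕ a) zero               ≡⟨ csuc^-toℕ a ⟩
    a                                ∎
    where
      open ≡-Reasoning
      period-zero : csuc^ (suc m) zero ≡ zero
      period-zero = trans (csuc^-csuc m zero)
        (trans (cong csuc (toℕ-injective (trans (toℕ-csuc^-zero m ≤-refl) (sym (toℕ-fromℕ m))))) (csuc-fromℕ m))

  private
    toℕ≤m : ∀ (a : Fin (suc m)) → toℕ a ≤ m
    toℕ≤m a = ≤-pred (toℕ<n a)

    csuc^-zero-injective : ∀ {s t} → s ≤ m → t ≤ m → csuc^ s zero ≡ csuc^ t zero → s ≡ t
    csuc^-zero-injective {s} {t} s≤m t≤m eq =
      trans (sym (toℕ-csuc^-zero s s≤m)) (trans (cong toℕ eq) (toℕ-csuc^-zero t t≤m))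

    csuc^-from-zero : ∀ d a → csuc^ d a ≡ csuc^ (d + toℕ a) zero
    csuc^-from-zero d a = trans (cong (csuc^ d) (sym (csuc^-toℕ a))) (sym (csuc^-+ d (toℕ a) zero))

  csuc^-no-fixpoint : ∀ d b → 0 < d → d ≤ m → csuc^ d b ≢ b
  csuc^-no-fixpoint d b 0<d d≤m eq with d + toℕ b ≤? m
  ... | yes fits = <-irrefl (sym (csuc^-zero-injective fits (toℕ≤m b) returns)) (m<n+m (toℕ b) 0<d)
    where
      returns : csuc^ (d + toℕ b) zero ≡ csuc^ (toℕ b) zero
      returns = trans (sym (csuc^-from-zero d b)) (trans eq (sym (csuc^-toℕ b)))
  ... | no overflows = <-irrefl (csuc^-zero-injective (≤-trans (<⇒≤ x<b) (toℕ≤m b)) (toℕ≤m b) returns) x<b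
    where
      x = d + toℕ b ∸ suc m
      x+period : x + suc m ≡ d + toℕ b
      x+period = m∸n+n≡m (≰⇒> overflows)
      x<b : x < toℕ b
      x<b = +-cancelʳ-< (suc m) x (toℕ b) (subst₂ _<_ (sym x+period) (+-comm (suc m) (toℕ b))
                                                  (+-monoˡ-< (toℕ b) (s≤s d≤m)))
      returns : csuc^ x zero ≡ csuc^ (toℕ b) zero
      returns = begin
        csuc^ x zero                ≡⟨ cong (csuc^ x) (sym (csuc^-period zero)) ⟩
        csuc^ x (csuc^ (suc m) zero) ≡⟨ sym (csuc^-+ x (suc m) zero) ⟩
        csuc^ (x + suc m) zero      ≡⟨ cong (λ t → csuc^ t zero) x+period ⟩
        csuc^ (d + toℕ b) zero      ≡⟨ sym (csuc^-from-zero d b) ⟩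
        csuc^ d b                   ≡⟨ eq ⟩
        b                           ≡⟨ sym (csuc^-toℕ b) ⟩
        csuc^ (toℕ b) zero          ∎
        where open ≡-Reasoning

  csuc^-injective : ∀ a {s t} → s < t → t ≤ m → csuc^ s a ≢ csuc^ t a
  csuc^-injective a {s} {t} s<t t≤m eq =
    csuc^-no-fixpoint (t ∸ s) (csuc^ s a) (m<n⇒0<n∸m s<t) (≤-trans (m∸n≤m t s) t≤m)
      (trans (sym (csuc^-+ (t ∸ s) s a)) (trans (cong (λ u → csuc^ u a) (m∸n+n≡m (<⇒≤ s<t))) (sym eq)))

  private
    csuc^-reaches-any : ∀ a b → ∃ λ d → d ≤ m × csuc^ d a ≡ b
    csuc^-reaches-any a b with toℕ a ≤? toℕ b
    ... | yes a≤b = toℕ b ∸ toℕ a , ≤-trans (m∸n≤m (toℕ b) (toℕ a)) (toℕ≤m b) , (begin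
      csuc^ (toℕ b ∸ toℕ a) a              ≡⟨ csuc^-from-zero (toℕ b ∸ toℕ a) a ⟩
      csuc^ (toℕ b ∸ toℕ a + toℕ a) zero   ≡⟨ cong (λ t → csuc^ t zero) (m∸n+n≡m a≤b) ⟩
      csuc^ (toℕ b) zero                  ≡⟨ csuc^-toℕ b ⟩
      b                                   ∎)
      where open ≡-Reasoning
    ... | no a≰b = toℕ b + rest , ≤-pred d<period , (begin
      csuc^ (toℕ b + rest) a              ≡⟨ csuc^-from-zero (toℕ b + rest) a ⟩
      csuc^ (toℕ b + rest + toℕ a) zero   ≡⟨ cong (λ t → csuc^ t zero) (+-assoc (toℕ b) rest (toℕ a)) ⟩
      csuc^ (toℕ b + (rest + toℕ a)) zero ≡⟨ cong (λ t → csuc^ (toℕ b + t) zero) (m∸n+n≡m (<⇒≤ (toℕ<n a))) ⟩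
      csuc^ (toℕ b + suc m) zero          ≡⟨ csuc^-+ (toℕ b) (suc m) zero ⟩
      csuc^ (toℕ b) (csuc^ (suc m) zero)  ≡⟨ cong (csuc^ (toℕ b)) (csuc^-period zero) ⟩
      csuc^ (toℕ b) zero                  ≡⟨ csuc^-toℕ b ⟩
      b                                   ∎)
      where
        open ≡-Reasoning
        rest = suc m ∸ toℕ a
        d<period : toℕ b + rest < suc m
        d<period = subst (toℕ b + rest <_) (m+[n∸m]≡n (<⇒≤ (toℕ<n a))) (+-monoˡ-< rest (≰⇒> a≰b))

  csuc^-reaches : ∀ a b → a ≢ b → ∃ λ d → 0 < d × d ≤ m × csuc^ d a ≡ b
  csuc^-reaches a b a≢b with csuc^-reaches-any a b
  ... | zero , _ , a≡b = ⊥-elim (a≢b a≡b)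
  ... | suc d , d≤m , reaches = suc d , s≤s z≤n , d≤m , reaches

module _ (c : Cyc A) where
  open CyclicShift {2 + len c}

  arcVertices : Fin (3 + len c) → ℕ → List A
  arcVertices a d = applyUpTo (λ t → vs c (csuc^ (suc t) a)) d

  arc-unique : ∀ a d → d ≤ 2 + len c → Unique (vs c a ∷ arcVertices a d)
  arc-unique a d d≤m = applyUpTo⁺₁ (λ t → vs c (csuc^ t a)) (suc d)
    (λ s<t t≤d → csuc^-injective a s<t (≤-trans (≤-pred t≤d) d≤m) ∘ inj c)

  module _ {ℓc} {C : Set ℓc} {F : C → EdgeSet A} where

    Carries : C → Set
    Carries κ = ∀ p → Adj (F κ) (vs c p) (vs c (csuc p))

    arc : ∀ a {cs : List C} → All Carries cs →
          Walk F (vs c a) (vs c (csuc^ (length cs) a)) (arcVertices a (length cs)) cs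
    arc a [] = stop
    arc a (carries ∷ all-carry) = step _ (carries a) (arc (csuc a) all-carry)

⋃L⁺ : ∀ {O : List (EdgeSet A)} {E u v} → E ∈ O → Adj E u v → ⋃L O u v
⋃L⁺ (here refl) e = inj₁ e
⋃L⁺ (there E∈) e = inj₂ (⋃L⁺ E∈ e)

⋃L⁻ : ∀ {O : List (EdgeSet A)} {u v} → ⋃L O u v → ∃ λ E → E ∈ O × Adj E u v
⋃L⁻ {O = E ∷ O} (inj₁ e) = E , here refl , e
⋃L⁻ {O = E ∷ O} (inj₂ p) with E′ , E′∈ , e ← ⋃L⁻ p = E′ , there E′∈ , e

VS-⋃L⁺ : ∀ {O : List (EdgeSet A)} {E u} → E ∈ O → VS E u → VS (⋃L O) u
VS-⋃L⁺ E∈ (v , e) = v , proj₁ e , inj₁ (⋃L⁺ E∈ e)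

VS-⋃L⁻ : ∀ {O : List (EdgeSet A)} {u} → VS (⋃L O) u → ∃ λ E → E ∈ O × VS E u
VS-⋃L⁻ (v , _ , inj₁ p) with E , E∈ , e ← ⋃L⁻ p = E , E∈ , v , e
VS-⋃L⁻ (v , _ , inj₂ p) with E , E∈ , e ← ⋃L⁻ p = E , E∈ , v , Adj-sym {E = E} e

VS-⋃L-resp-↭ : ∀ {O O′ : List (EdgeSet A)} {u} → O ↭ O′ → VS (⋃L O) u → VS (⋃L O′) u
VS-⋃L-resp-↭ O↭O′ q with E , E∈ , s ← VS-⋃L⁻ q = VS-⋃L⁺ (∈-resp-↭ O↭O′ E∈) s

VS-⋃L-++⁻ : ∀ (O₁ : List (EdgeSet A)) {O₂ u} → VS (⋃L (O₁ ++ O₂)) u → VS (⋃L O₁) u ⊎ VS (⋃L O₂) u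
VS-⋃L-++⁻ O₁ q with E , E∈ , s ← VS-⋃L⁻ q with ∈-++⁻ O₁ E∈
... | inj₁ E∈₁ = inj₁ (VS-⋃L⁺ E∈₁ s)
... | inj₂ E∈₂ = inj₂ (VS-⋃L⁺ E∈₂ s)

VS-⋃L-++⁺ˡ : ∀ {O₁ O₂ : List (EdgeSet A)} {u} → VS (⋃L O₁) u → VS (⋃L (O₁ ++ O₂)) u
VS-⋃L-++⁺ˡ q with E , E∈ , s ← VS-⋃L⁻ q = VS-⋃L⁺ (∈-++⁺ˡ E∈) s

VS-⋃L-++⁺ʳ : ∀ (O₁ : List (EdgeSet A)) {O₂ u} → VS (⋃L O₂) u → VS (⋃L (O₁ ++ O₂)) u
VS-⋃L-++⁺ʳ O₁ q with E , E∈ , s ← VS-⋃L⁻ q = VS-⋃L⁺ (∈-++⁺ʳ O₁ E∈) s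

VS-⋃L-tabulate⁻ : ∀ {r} (G : Fin r → EdgeSet A) {x} → VS (⋃L (tabulate G)) x → ∃ λ j → VS (G j) x
VS-⋃L-tabulate⁻ G q with E , E∈ , s ← VS-⋃L⁻ q with j , refl ← ∈-tabulate⁻ E∈ = j , s

VS-⋃F⁺ : ∀ {r} {G : Fin r → EdgeSet A} {j x} → VS (G j) x → VS (⋃F G) x
VS-⋃F⁺ (w , e) = w , proj₁ e , inj₁ (_ , e)

module Without {A : Set} (_≟_ : DecidableEquality A) where

  _without_ : List A → A → List A
  xs without s = filter (λ z → ¬? (z ≟ s)) xs

  length-without : ∀ s {xs} → Unique xs → length xs ≤ suc (length (xs without s))
  length-without s {[]} _ = z≤n
  length-without s {x ∷ xs} (x∉ ∷ u) with x ≟ s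
  ... | no _ = s≤s (length-without s u)
  ... | yes refl = s≤s (subst (length xs ≤_) (sym (cong length (filter-all (λ z → ¬? (z ≟ x)) (All-≢-sym x∉)))) ≤-refl)

  Unique-without : ∀ s {xs} → Unique xs → Unique (xs without s)
  Unique-without s = Unique-filter⁺ (λ z → ¬? (z ≟ s))

  ∈-without⁻ : ∀ s {xs z} → z ∈ xs without s → z ∈ xs × z ≢ s
  ∈-without⁻ s = ∈-filter⁻ (λ z → ¬? (z ≟ s))

module Saguaros {A : Set} (_≟_ : DecidableEquality A) where
  open Without _≟_
  open import Data.List.Membership.DecPropositional _≟_ using (_∈?_)

  ManySpannedVertices : List (EdgeSet A) → Set
  ManySpannedVertices O = Σ (List A) λ S → Unique S × suc (length O) ≤ length S × All (VS (⋃L O)) S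

  private
    spanned-in-union : ∀ {O O₁ O₂ : List (EdgeSet A)} → O ↭ O₁ ++ O₂ →
                       (∀ {u} → VS (⋃L O₁) u → VS (⋃L O) u) × (∀ {u} → VS (⋃L O₂) u → VS (⋃L O) u)
    spanned-in-union {O₁ = O₁} O↭ =
      (λ q → VS-⋃L-resp-↭ (↭-sym O↭) (VS-⋃L-++⁺ˡ q)) , (λ q → VS-⋃L-resp-↭ (↭-sym O↭) (VS-⋃L-++⁺ʳ O₁ q))

    count : ∀ {O O₁ O₂ : List (EdgeSet A)} {S₁ S₂ : List A} → O ↭ O₁ ++ O₂ →
            suc (length O₁) ≤ length S₁ → length O₂ ≤ length S₂ → suc (length O) ≤ length (S₁ ++ S₂)
    count {O₁ = O₁} {S₁ = S₁} {S₂} O↭ l₁ l₂ =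
      subst (_≤ length (S₁ ++ S₂)) (cong suc (sym (trans (↭-length O↭) (length-++ O₁)))) (length-++-≥ S₁ l₁ l₂)

  cactus-vertices : ∀ {O} → PrunedCactus O → ManySpannedVertices O
  cactus-vertices {[]} (identical c _ ())
  cactus-vertices {E ∷ O} (identical c (E-cycle ∷ _) vertex-count) =
    tabulate (vs c) , Unique-tabulate⁺ (inj c) ,
    subst₂ _≤_ vertex-count (sym (length-tabulate (vs c))) ≤-refl ,
    All.tabulate⁺ (λ i → VS-⋃L⁺ {E = E} (here refl) (vs c (csuc i) , proj₂ (E-cycle _ _) (i , inj₁ (refl , refl))))
  cactus-vertices (glue {O₁ = O₁} O↭ p₁ p₂ (s , _ , _ , only-s))
    with S₁ , u₁ , l₁ , a₁ ← cactus-vertices p₁ | S₂ , u₂ , l₂ , a₂ ← cactus-vertices p₂ =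
    S₁ ++ S₂ without s ,
    ++⁺ u₁ (Unique-without s u₂) disjoint ,
    count {O₁ = O₁} {S₁ = S₁} O↭ l₁ (≤-pred (≤-trans l₂ (length-without s u₂))) ,
    All.++⁺ (All.map (proj₁ (spanned-in-union O↭)) a₁)
            (All.tabulate (λ z∈ → proj₂ (spanned-in-union O↭) (All.lookup a₂ (proj₁ (∈-without⁻ s z∈)))))
    where
      disjoint : ∀ {z} → ¬ (z ∈ S₁ × z ∈ S₂ without s)
      disjoint (z∈₁ , z∈₂) with z∈S₂ , z≢s ← ∈-without⁻ s z∈₂ = z≢s (only-s _ (All.lookup a₁ z∈₁) (All.lookup a₂ z∈S₂))

  saguaro-vertices : ∀ {O} → Saguaro O → ManySpannedVertices O
  saguaro-vertices (cactus p) = cactus-vertices p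
  saguaro-vertices (join {O₁ = O₁} {O₂} {E} O↭ s₁ s₂ disjoint _ _ _ _)
    with S₁ , u₁ , l₁ , a₁ ← saguaro-vertices s₁ | S₂ , u₂ , l₂ , a₂ ← saguaro-vertices s₂ =
    S₁ ++ S₂ ,
    ++⁺ u₁ u₂ (λ (z∈₁ , z∈₂) → disjoint _ (All.lookup a₁ z∈₁) (All.lookup a₂ z∈₂)) ,
    count {O₁ = O₁} {S₁ = S₁} O↭ l₁ l₂ ,
    All.++⁺ (All.map (proj₁ (spanned-in-union O↭)) a₁)
            (All.map (λ q → proj₂ (spanned-in-union O↭) (VS-⋃L-++⁺ʳ [ E ] q)) a₂)

  SubBag : List (EdgeSet A) → List (EdgeSet A) → Set₁
  SubBag cs O = ∃ λ rest → O ↭ cs ++ rest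

  private
    SubBag-++ˡ : ∀ {O O₁ O₂ cs} → O ↭ O₁ ++ O₂ → SubBag cs O₁ → SubBag cs O
    SubBag-++ˡ {O₂ = O₂} {cs} O↭ (rest , p) =
      rest ++ O₂ , ↭-trans O↭ (↭-trans (↭-++⁺ʳ O₂ p) (↭-reflexive (++-assoc cs rest O₂)))

    SubBag-++ʳ : ∀ {O O₁ O₂ cs} → O ↭ O₁ ++ O₂ → SubBag cs O₂ → SubBag cs O
    SubBag-++ʳ {O₁ = O₁} {cs = cs} O↭ (rest , p) =
      O₁ ++ rest , ↭-trans O↭ (↭-trans (↭-++⁺ˡ O₁ p) (shifts O₁ cs))

    SubBag-++ : ∀ {O O₁ O₂ cs₁ cs₂} → O ↭ O₁ ++ O₂ → SubBag cs₁ O₁ → SubBag cs₂ O₂ → SubBag (cs₁ ++ cs₂) O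
    SubBag-++ {cs₁ = cs₁} {cs₂} O↭ (rest₁ , p₁) (rest₂ , p₂) = rest₁ ++ rest₂ , (begin
      _                              ↭⟨ O↭ ⟩
      _                              ↭⟨ ↭-++⁺ p₁ p₂ ⟩
      (cs₁ ++ rest₁) ++ cs₂ ++ rest₂ ≡⟨ ++-assoc cs₁ rest₁ (cs₂ ++ rest₂) ⟩
      cs₁ ++ rest₁ ++ cs₂ ++ rest₂   ↭⟨ ↭-++⁺ˡ cs₁ (shifts rest₁ cs₂) ⟩
      cs₁ ++ cs₂ ++ rest₁ ++ rest₂   ≡⟨ ++-assoc cs₁ cs₂ (rest₁ ++ rest₂) ⟨
      (cs₁ ++ cs₂) ++ rest₁ ++ rest₂ ∎)
      where open PermutationReasoning

    SubBag-∷ : ∀ {O cs} E → SubBag cs O → SubBag (E ∷ cs) (E ∷ O)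
    SubBag-∷ E (rest , p) = rest , ↭-prep E p

    SubBag-there : ∀ {O cs} E → SubBag cs O → SubBag cs (E ∷ O)
    SubBag-there {cs = cs} E (rest , p) = E ∷ rest , ↭-trans (↭-prep E p) (↭-sym (shift E cs rest))

    SubBag-resp-↭ : ∀ {O cs cs′} → cs′ ↭ cs → SubBag cs O → SubBag cs′ O
    SubBag-resp-↭ q (rest , p) = rest , ↭-trans p (↭-++⁺ʳ rest (↭-sym q))

  record RainbowPath (O : List (EdgeSet A)) (x y : A) : Set₁ where
    constructor rainbowPath
    field
      via      : List A
      colours  : List (EdgeSet A)
      walk     : Walk id x y via colours
      distinct : Unique (x ∷ via)
      sub      : SubBag colours O
      spanned  : All (VS (⋃L O)) (x ∷ via)
  open RainbowPath

  LongRainbowPath : List (EdgeSet A) → A → A → Set₁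
  LongRainbowPath O x y = Σ (RainbowPath O x y) λ p → 2 ≤ length (via p)

  RainbowConnected : List (EdgeSet A) → Set₁
  RainbowConnected O = ∀ x y → VS (⋃L O) x → VS (⋃L O) y → x ≢ y → LongRainbowPath O x y

  private
    trivialPath : ∀ {O x} → VS (⋃L O) x → RainbowPath O x x
    trivialPath {O} x∈ = rainbowPath [] [] stop ([] ∷ []) (O , ↭-refl) (x∈ ∷ [])

    weakenPath : ∀ {O₁ O x y} → (∀ {z} → VS (⋃L O₁) z → VS (⋃L O) z) →
                 (∀ {cs} → SubBag cs O₁ → SubBag cs O) → RainbowPath O₁ x y → RainbowPath O x y
    weakenPath f g (rainbowPath ts cs w u b s) = rainbowPath ts cs w u (g b) (All.map f s)

    reversePath : ∀ {O x y} (p : RainbowPath O x y) → Σ (RainbowPath O y x) λ p′ → length (via p′) ≡ length (via p)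
    reversePath (rainbowPath ts cs w u b s) with ts′ , cs′ , w′ , ts↭ , cs↭ ← reverseᵂ w =
      rainbowPath ts′ cs′ w′ (Unique-resp-↭ (↭-sym ts↭) u) (SubBag-resp-↭ cs↭ b) (All-resp-↭ (↭-sym ts↭) s) ,
      suc-injective (↭-length ts↭)

    reverseLongPath : ∀ {O x y} → LongRainbowPath O x y → LongRainbowPath O y x
    reverseLongPath (p , long) with p′ , same ← reversePath p = p′ , subst (2 ≤_) (sym same) long

    connect : ∀ {O x y} → RainbowConnected O → VS (⋃L O) x → VS (⋃L O) y → RainbowPath O x y
    connect {x = x} {y} conn x∈ y∈ with x ≟ y
    ... | yes refl = trivialPath x∈
    ... | no x≢y = proj₁ (conn x y x∈ y∈ x≢y)

  module _ (c : Cyc A) {O : List (EdgeSet A)} (O-cycles : All (λ E → IsCycleOn E c) O)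
           (vertex-count : nverts c ≡ suc (length O)) where
    open CyclicShift {2 + len c}

    private
      length-O : length O ≡ 2 + len c
      length-O = suc-injective (sym vertex-count)

      cycle-carries : ∀ {E} → IsCycleOn E c → Carries c {F = id} E
      cycle-carries E-cycle p = proj₂ (E-cycle _ _) (p , inj₁ (refl , refl))

      position : ∀ {z} → VS (⋃L O) z → ∃ λ i → vs c i ≡ z
      position z∈ with E , E∈ , v , e ← VS-⋃L⁻ z∈ with proj₁ (All.lookup O-cycles E∈ _ _) e
      ... | i , inj₁ (i↦z , _) = i , i↦z
      ... | i , inj₂ (_ , i+1↦z) = csuc i , i+1↦z

      spanned-by-cycles : ∀ {O′} → All (λ E → IsCycleOn E c) O′ → 1 ≤ length O′ → ∀ p → VS (⋃L O′) (vs c p)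
      spanned-by-cycles {E ∷ _} (E-cycle ∷ _) _ p = VS-⋃L⁺ {E = E} (here refl) (_ , cycle-carries {E} E-cycle p)

      on-cycle-spanned : ∀ p → VS (⋃L O) (vs c p)
      on-cycle-spanned = spanned-by-cycles O-cycles (subst (1 ≤_) (sym length-O) (s≤s z≤n))

      length-take-O : ∀ {d} → d ≤ 2 + len c → length (take d O) ≡ d
      length-take-O {d} d≤m = trans (length-take d O) (m≤n⇒m⊓n≡m (subst (d ≤_) (sym length-O) d≤m))

      O-carries : All (Carries c {F = id}) O
      O-carries = All.map (λ {E} → cycle-carries {E}) O-cycles

      arcPath : ∀ a {cs} → SubBag cs O → All (Carries c {F = id}) cs → length cs ≤ 2 + len c →
                Σ (RainbowPath O (vs c a) (vs c (csuc^ (length cs) a))) λ p → length (via p) ≡ length cs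
      arcPath a {cs} sub carries short =
        rainbowPath _ cs (arc c a carries) (arc-unique c a _ short) sub
          (on-cycle-spanned a ∷ All.tabulate (λ z∈ → case ∈-applyUpTo⁻ _ z∈ of λ (_ , _ , z≡) →
             subst (VS (⋃L O)) (sym z≡) (on-cycle-spanned _))) ,
        length-applyUpTo _ (length cs)

    identical-connected : RainbowConnected O
    identical-connected x y x∈ y∈ x≢y with a , refl ← position x∈ | b , refl ← position y∈
      with csuc^-reaches a b (x≢y ∘ cong (vs c))
    -- y follows x on the cycle: take the arc the other way round.
    ... | suc zero , _ , _ , a→b with p , |p| ← arcPath b ([] , ↭-reflexive (sym (++-identityʳ O)))
                                                    O-carries (≤-reflexive length-O) =
      reverseLongPath (subst (λ z → LongRainbowPath O (vs c b) z) (cong (vs c) b→a)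
                        (p , subst (2 ≤_) (sym (trans |p| length-O)) (s≤s (s≤s z≤n))))
      where
        b→a : csuc^ (length O) b ≡ a
        b→a = begin
          csuc^ (length O) b            ≡⟨ cong₂ csuc^ length-O (sym a→b) ⟩
          csuc^ (2 + len c) (csuc^ 1 a) ≡⟨ csuc^-+ (2 + len c) 1 a ⟨
          csuc^ (2 + len c + 1) a       ≡⟨ cong (λ t → csuc^ t a) (+-comm (2 + len c) 1) ⟩
          csuc^ (3 + len c) a           ≡⟨ csuc^-period a ⟩
          a                             ∎
          where open ≡-Reasoning
    ... | d@(suc (suc _)) , _ , d≤m , a→b with p , |p| ← arcPath a {take d O} (drop d O , ↭-reflexive (sym (take++drop≡id d O)))
                                                   (All.take⁺ d O-carries) (subst (_≤ _) (sym (length-take-O d≤m)) d≤m) =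
      subst (λ z → LongRainbowPath O (vs c a) z) (cong (vs c) (trans (cong (λ t → csuc^ t a) (length-take-O d≤m)) a→b))
        (p , subst (2 ≤_) (sym (trans |p| (length-take-O d≤m))) (s≤s (s≤s z≤n)))

  module _ {O O₁ O₂ : List (EdgeSet A)} (O↭ : O ↭ O₁ ++ O₂) (s : A) (s∈₁ : VS (⋃L O₁) s) (s∈₂ : VS (⋃L O₂) s)
           (only-s : ∀ y → VS (⋃L O₁) y → VS (⋃L O₂) y → y ≡ s)
           (conn₁ : RainbowConnected O₁) (conn₂ : RainbowConnected O₂) where

    private
      lift₁ : ∀ {x y} → LongRainbowPath O₁ x y → LongRainbowPath O x y
      lift₁ (p , long) = weakenPath (proj₁ (spanned-in-union O↭)) (SubBag-++ˡ O↭) p , long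

      lift₂ : ∀ {x y} → LongRainbowPath O₂ x y → LongRainbowPath O x y
      lift₂ (p , long) = weakenPath (proj₂ (spanned-in-union O↭)) (SubBag-++ʳ O↭) p , long

      through-s : ∀ x y → VS (⋃L O₁) x → VS (⋃L O₂) y → x ≢ y → LongRainbowPath O x y
      through-s x y x∈ y∈ x≢y with x ≟ s | y ≟ s
      ... | yes refl | _ = lift₂ (conn₂ x y s∈₂ y∈ x≢y)
      ... | no _ | yes refl = lift₁ (conn₁ x y x∈ s∈₁ x≢y)
      ... | no x≢s | no y≢s
        with rainbowPath ts₁ cs₁ w₁ u₁ b₁ v₁ , long ← conn₁ x s x∈ s∈₁ x≢s
           | rainbowPath ts₂ cs₂ w₂ (s∉ts₂ ∷ u₂) b₂ (_ ∷ v₂) , _ ← conn₂ s y s∈₂ y∈ (y≢s ∘ sym) =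
        rainbowPath (ts₁ ++ ts₂) (cs₁ ++ cs₂) (w₁ ++ᵂ w₂) (++⁺ u₁ u₂ meet-only-at-s) (SubBag-++ O↭ b₁ b₂)
          (All.++⁺ (All.map (proj₁ (spanned-in-union O↭)) v₁) (All.map (proj₂ (spanned-in-union O↭)) v₂)) ,
        length-++-≥ {n = 0} ts₁ long z≤n
        where
          meet-only-at-s : ∀ {z} → ¬ (z ∈ x ∷ ts₁ × z ∈ ts₂)
          meet-only-at-s (z∈₁ , z∈₂) = All.lookup s∉ts₂ z∈₂ (sym (only-s _ (All.lookup v₁ z∈₁) (All.lookup v₂ z∈₂)))

    glue-connected : RainbowConnected O
    glue-connected x y x∈ y∈ x≢y
      with VS-⋃L-++⁻ O₁ (VS-⋃L-resp-↭ O↭ x∈) | VS-⋃L-++⁻ O₁ (VS-⋃L-resp-↭ O↭ y∈)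
    ... | inj₁ x∈₁ | inj₁ y∈₁ = lift₁ (conn₁ x y x∈₁ y∈₁ x≢y)
    ... | inj₂ x∈₂ | inj₂ y∈₂ = lift₂ (conn₂ x y x∈₂ y∈₂ x≢y)
    ... | inj₁ x∈₁ | inj₂ y∈₂ = through-s x y x∈₁ y∈₂ x≢y
    ... | inj₂ x∈₂ | inj₁ y∈₁ = reverseLongPath (through-s y x y∈₁ x∈₂ (x≢y ∘ sym))

  module _ {O O₁ O₂ : List (EdgeSet A)} {E : EdgeSet A} (O↭ : O ↭ O₁ ++ E ∷ O₂)
           (conn₁ : RainbowConnected O₁) (conn₂ : RainbowConnected O₂)
           (disjoint : ∀ x → VS (⋃L O₁) x → ¬ VS (⋃L O₂) x) (c : Cyc A) (E-cycle : IsCycleOn E c)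
           (alternating : ∀ i → (VS (⋃L O₁) (vs c i) × VS (⋃L O₂) (vs c (csuc i)))
                              ⊎ (VS (⋃L O₂) (vs c i) × VS (⋃L O₁) (vs c (csuc i)))) where

    private
      in-O₁ : ∀ {z} → VS (⋃L O₁) z → VS (⋃L O) z
      in-O₁ = proj₁ (spanned-in-union O↭)

      in-O₂ : ∀ {z} → VS (⋃L O₂) z → VS (⋃L O) z
      in-O₂ q = proj₂ (spanned-in-union O↭) (VS-⋃L-++⁺ʳ [ E ] q)

      lift₁ : ∀ {x y} → LongRainbowPath O₁ x y → LongRainbowPath O x y
      lift₁ (p , long) = weakenPath in-O₁ (SubBag-++ˡ O↭) p , long

      lift₂ : ∀ {x y} → LongRainbowPath O₂ x y → LongRainbowPath O x y
      lift₂ (p , long) = weakenPath in-O₂ (SubBag-++ʳ O↭ ∘ SubBag-there E) p , long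

      side : ∀ {z} → VS (⋃L O) z → VS (⋃L O₁) z ⊎ VS (⋃L O₂) z
      side q with VS-⋃L-++⁻ O₁ (VS-⋃L-resp-↭ O↭ q)
      ... | inj₁ q₁ = inj₁ q₁
      ... | inj₂ q′ with VS-⋃L-++⁻ [ E ] q′
      ... | inj₂ q₂ = inj₂ q₂
      ... | inj₁ qE with VS-⋃L⁻ qE
      ... | .E , here refl , v , e with proj₁ (E-cycle _ v) e
      ... | i , inj₁ (refl , _) = [ inj₁ ∘ proj₁ , inj₂ ∘ proj₁ ]′ (alternating i)
      ... | i , inj₂ (_ , refl) = [ inj₂ ∘ proj₂ , inj₁ ∘ proj₂ ]′ (alternating i)

      cycle-edge : ∀ i → Adj E (vs c i) (vs c (csuc i))
      cycle-edge i = proj₂ (E-cycle _ _) (i , inj₁ (refl , refl))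

      v₀≢v₂ : vs c zero ≢ vs c (csuc (csuc zero))
      v₀≢v₂ e with inj c e
      ... | ()

      crossing-edge : ∀ x y → Σ A λ a → Σ A λ b → Adj E a b × VS (⋃L O₁) a × VS (⋃L O₂) b × (x ≢ a ⊎ y ≢ b)
      crossing-edge x y with alternating zero | alternating (csuc zero)
      ... | inj₁ (_ , v₁∈₁) | inj₁ (v₁∈₂ , _) = ⊥-elim (disjoint _ v₁∈₂ v₁∈₁)
      ... | inj₂ (_ , v₁∈₁) | inj₂ (v₁∈₂ , _) = ⊥-elim (disjoint _ v₁∈₁ v₁∈₂)
      ... | inj₁ (v₀∈₁ , v₁∈₂) | inj₂ (_ , v₂∈₁) with x ≟ vs c zero
      ...   | no x≢v₀ = _ , _ , cycle-edge zero , v₀∈₁ , v₁∈₂ , inj₁ x≢v₀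
      ...   | yes x≡v₀ = _ , _ , Adj-sym {E = E} (cycle-edge (csuc zero)) , v₂∈₁ , v₁∈₂ , inj₁ (v₀≢v₂ ∘ trans (sym x≡v₀))
      crossing-edge x y | inj₂ (v₀∈₂ , v₁∈₁) | inj₁ (_ , v₂∈₂) with y ≟ vs c zero
      ...   | no y≢v₀ = _ , _ , Adj-sym {E = E} (cycle-edge zero) , v₁∈₁ , v₀∈₂ , inj₂ y≢v₀
      ...   | yes y≡v₀ = _ , _ , cycle-edge (csuc zero) , v₁∈₁ , v₂∈₂ , inj₂ (v₀≢v₂ ∘ trans (sym y≡v₀))

      joinPaths : ∀ {x a b y} → RainbowPath O₁ x a → Adj E a b → RainbowPath O₂ b y → RainbowPath O x y
      joinPaths {x} {b = b} (rainbowPath ts₁ cs₁ w₁ u₁ b₁ v₁) e (rainbowPath ts₂ cs₂ w₂ u₂ b₂ v₂) =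
        rainbowPath (ts₁ ++ b ∷ ts₂) (cs₁ ++ E ∷ cs₂) (w₁ ++ᵂ step E e w₂)
          (++⁺ u₁ u₂ (λ (z∈₁ , z∈₂) → disjoint _ (All.lookup v₁ z∈₁) (All.lookup v₂ z∈₂)))
          (SubBag-++ O↭ b₁ (SubBag-∷ E b₂)) (All.++⁺ (All.map in-O₁ v₁) (All.map in-O₂ v₂))

      across : ∀ x y → VS (⋃L O₁) x → VS (⋃L O₂) y → LongRainbowPath O x y
      across x y x∈ y∈ with crossing-edge x y
      ... | a , b , e , a∈ , b∈ , inj₁ x≢a with p₁ , long ← conn₁ x a x∈ a∈ x≢a =
        joinPaths p₁ e (connect conn₂ b∈ y∈) , length-++-≥ {n = 0} (via p₁) long z≤n
      ... | a , b , e , a∈ , b∈ , inj₂ y≢b with p₂ , long ← conn₂ b y b∈ y∈ (y≢b ∘ sym) =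
        joinPaths p₁ e p₂ , length-++-≥ {m = 0} (via p₁) z≤n (≤-trans long (n≤1+n _))
        where p₁ = connect conn₁ x∈ a∈

    join-connected : RainbowConnected O
    join-connected x y x∈ y∈ x≢y with side x∈ | side y∈
    ... | inj₁ x∈₁ | inj₁ y∈₁ = lift₁ (conn₁ x y x∈₁ y∈₁ x≢y)
    ... | inj₂ x∈₂ | inj₂ y∈₂ = lift₂ (conn₂ x y x∈₂ y∈₂ x≢y)
    ... | inj₁ x∈₁ | inj₂ y∈₂ = across x y x∈₁ y∈₂
    ... | inj₂ x∈₂ | inj₁ y∈₁ = reverseLongPath (across y x y∈₁ x∈₂)

  cactus-connected : ∀ {O} → PrunedCactus O → RainbowConnected O
  cactus-connected (identical c O-cycles vertex-count) = identical-connected c O-cycles vertex-count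
  cactus-connected (glue O↭ p₁ p₂ (s , s∈₁ , s∈₂ , only-s)) =
    glue-connected O↭ s s∈₁ s∈₂ only-s (cactus-connected p₁) (cactus-connected p₂)

  saguaro-connected : ∀ {O} → Saguaro O → RainbowConnected O
  saguaro-connected (cactus p) = cactus-connected p
  saguaro-connected (join O↭ s₁ s₂ disjoint c E-cycle _ alternating) =
    join-connected O↭ (saguaro-connected s₁) (saguaro-connected s₂) disjoint c E-cycle alternating

  saguaro-spans : ∀ {O} (W : A → Set) → Saguaro O → (∀ z → VS (⋃L O) z → W z) →
                  (∀ xs → Unique xs → All W xs → length xs ≤ suc (length O)) → ∀ x → W x → VS (⋃L O) x
  saguaro-spans W sg spanned⊆W few x Wx with S , distinct , many , spanned ← saguaro-vertices sg with x ∈? S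
  ... | yes x∈ = All.lookup spanned x∈
  ... | no x∉ = ⊥-elim (<-irrefl refl (≤-trans many (≤-pred (few (x ∷ S) distinct′ (Wx ∷ All.map (spanned⊆W _) spanned)))))
    where distinct′ = All.tabulate (λ z∈ x≡z → x∉ (subst (_∈ S) (sym x≡z) z∈)) ∷ distinct

  SubBag-tabulate⁻ : ∀ {r} (G : Fin r → EdgeSet A) {cs} → SubBag cs (tabulate G) → ∃ λ js → Unique js × map G js ≡ cs
  SubBag-tabulate⁻ {r} G {cs} (rest , ↭cs++rest)
    with ys , cs++rest≡ , allFin↭ys ← ↭-map-inv G (subst (_↭ cs ++ rest) (sym (map-tabulate id G)) ↭cs++rest)
    with js , _ , refl , refl ← map-++⁻ G ys cs (sym cs++rest≡) =
    js , Unique-++⁻ˡ js (Unique-resp-↭ allFin↭ys (allFin⁺ r)) , refl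

module _ {k r : ℕ} where

  ↑ˡ≢↑ʳ : (j : Fin k) (i : Fin r) → j ↑ˡ r ≢ k ↑ʳ i
  ↑ˡ≢↑ʳ j i e with trans (sym (splitAt-↑ˡ k j r)) (trans (cong (splitAt k) e) (splitAt-↑ʳ k r i))
  ... | ()

  module _ {A : Set} (K : Fin k → EdgeSet A) (L : Fin r → EdgeSet A) where

    liftᴷ : ∀ {x y ts cs} → Walk K x y ts cs → Walk (K ++ᶠ L) x y ts (map (_↑ˡ r) cs)
    liftᴷ = mapᵂ (_↑ˡ r) (λ j → subst (λ E → Adj E _ _) (sym (lookup-++ˡ K L j)))

    liftᴸ : ∀ {x y ts cs} → Walk L x y ts cs → Walk (K ++ᶠ L) x y ts (map (k ↑ʳ_) cs)
    liftᴸ = mapᵂ (k ↑ʳ_) (λ i → subst (λ E → Adj E _ _) (sym (lookup-++ʳ K L i)))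

    K-then-L-cycle : ∀ {x y z ts us cs ds c} → Walk K x y ts cs → Walk L y z us ds →
                     Unique (x ∷ ts ++ us) → Unique cs → Unique (c ∷ ds) → Adj (L c) z x →
                     2 ≤ length (ts ++ us) → RainbowCycle (K ++ᶠ L)
    K-then-L-cycle {cs = cs} {ds} {c} p q distinct-vertices distinct-cs distinct-cds closing long = closedWalk⇒rainbowCycle record
      { walk              = liftᴷ p ++ᵂ liftᴸ q
      ; distinct-vertices = distinct-vertices
      ; distinct-colours  = Unique-resp-↭ (shift (k ↑ʳ c) (map (_↑ˡ r) cs) (map (k ↑ʳ_) ds))
          (++⁺ (map⁺ (↑ˡ-injective r _ _) distinct-cs) (map⁺ (↑ʳ-injective k _ _) distinct-cds) K-L-disjoint)
      ; closing-edge      = subst (λ E → Adj E _ _) (sym (lookup-++ʳ K L c)) closing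
      ; long              = long
      }
      where
        K-L-disjoint : ∀ {i} → ¬ (i ∈ map (_↑ˡ r) cs × i ∈ map (k ↑ʳ_) (c ∷ ds))
        K-L-disjoint (i∈ᴷ , i∈ᴸ) with ∈-map⁻ (_↑ˡ r) i∈ᴷ | ∈-map⁻ (k ↑ʳ_) i∈ᴸ
        ... | j , _ , refl | i , _ , e = ↑ˡ≢↑ʳ j i e

    RainbowPathIn⇒Walk : ∀ {H : EdgeSet A} {ℓ u v} → 1 ≤ ℓ → RainbowPathIn K H ℓ u v →
      ∃₂ λ ts cs → Walk K u v ts cs × Unique (u ∷ ts) × Unique cs × length ts ≡ ℓ × All (VS H) (u ∷ ts)
    RainbowPathIn⇒Walk {H} {suc ℓ} _ (w , w-inj , refl , refl , σ , σ-inj , edge) =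
      tabulate (λ i → w (suc i)) , tabulate σ , tabulateᵂ w σ (λ j → proj₂ (edge j)) ,
      Unique-tabulate⁺ w-inj , Unique-tabulate⁺ σ-inj , length-tabulate (λ i → w (suc i)) ,
      All.tabulate⁺ {f = w} in-H
      where
        in-H : ∀ i → VS H (w i)
        in-H i with lastView i
        ... | last = w (inject₁ (fromℕ ℓ)) , Adj-sym {E = H} (proj₁ (edge (fromℕ ℓ)))
        ... | inject j = w (suc j) , proj₁ (edge j)

Contr-mono : ∀ {Q : EdgeSet A} {c̄} {E E′ : EdgeSet A} → (∀ {a b} → Adj E a b → Adj E′ a b) →
             ∀ {x y} → Adj (Contr Q c̄ E) x y → Adj (Contr Q c̄ E′) x y
Contr-mono E⊆E′ (x≢y , inj₁ (x≢y′ , a , b , e , x↤ , y↤)) = x≢y , inj₁ (x≢y′ , a , b , E⊆E′ e , x↤ , y↤)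
Contr-mono E⊆E′ (x≢y , inj₂ (y≢x , a , b , e , y↤ , x↤)) = x≢y , inj₂ (y≢x , a , b , E⊆E′ e , y↤ , x↤)

module _ {A : Set} (Q : EdgeSet A) (c̄ : A) where

  ContrV-away : ∀ {u a} → ContrV Q c̄ u a → a ≢ c̄ → u ≡ a
  ContrV-away (inj₁ (_ , a≡c̄)) a≢c̄ = ⊥-elim (a≢c̄ a≡c̄)
  ContrV-away (inj₂ (_ , a≡u)) _ = sym a≡u

  ContrV-c̄ : VS Q c̄ → ∀ {u} → ContrV Q c̄ u c̄ → VS Q u
  ContrV-c̄ _ (inj₁ (u∈Q , _)) = u∈Q
  ContrV-c̄ c̄∈Q (inj₂ (u∉Q , c̄≡u)) = ⊥-elim (u∉Q (subst (VS Q) c̄≡u c̄∈Q))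

  ContrV-vertex : ∀ {u a} → ContrV Q c̄ u a → ContrVertex Q c̄ a
  ContrV-vertex (inj₁ (_ , a≡c̄)) = inj₁ a≡c̄
  ContrV-vertex (inj₂ (u∉Q , a≡u)) = inj₂ (subst (λ z → ¬ VS Q z) (sym a≡u) u∉Q)

  module _ {E : EdgeSet A} where

    Contr-vertex : ∀ {a b} → Adj (Contr Q c̄ E) a b → ContrVertex Q c̄ b
    Contr-vertex (_ , inj₁ (_ , _ , _ , _ , _ , b↤)) = ContrV-vertex b↤
    Contr-vertex (_ , inj₂ (_ , _ , _ , _ , b↤ , _)) = ContrV-vertex b↤

    Contr-away : ∀ {a b} → a ≢ c̄ → b ≢ c̄ → Adj (Contr Q c̄ E) a b → Adj E a b
    Contr-away a≢ b≢ (_ , inj₁ (_ , _ , _ , e , a↤ , b↤)) = subst₂ (Adj E) (ContrV-away a↤ a≢) (ContrV-away b↤ b≢) e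
    Contr-away a≢ b≢ (_ , inj₂ (_ , _ , _ , e , b↤ , a↤)) =
      Adj-sym {E = E} (subst₂ (Adj E) (ContrV-away b↤ b≢) (ContrV-away a↤ a≢) e)

    Contr-at-c̄ : VS Q c̄ → ∀ {b} → b ≢ c̄ → Adj (Contr Q c̄ E) c̄ b → ∃ λ v → VS Q v × Adj E v b
    Contr-at-c̄ c̄∈Q b≢ (_ , inj₁ (_ , u , _ , e , c̄↤ , b↤)) = u , ContrV-c̄ c̄∈Q c̄↤ , subst (Adj E u) (ContrV-away b↤ b≢) e
    Contr-at-c̄ c̄∈Q b≢ (_ , inj₂ (_ , _ , v , e , b↤ , c̄↤)) =
      v , ContrV-c̄ c̄∈Q c̄↤ , Adj-sym {E = E} (subst (λ z → Adj E z v) (ContrV-away b↤ b≢) e)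

    Contr-spanned : ∀ {a b} → Adj (Contr Q c̄ E) a b → a ≢ c̄ → VS E a
    Contr-spanned (_ , inj₁ (_ , _ , v , e , a↤ , _)) a≢ = v , subst (λ z → Adj E z v) (ContrV-away a↤ a≢) e
    Contr-spanned (_ , inj₂ (_ , u , _ , e , _ , a↤)) a≢ =
      u , subst (λ z → Adj E z u) (ContrV-away a↤ a≢) (Adj-sym {E = E} e)

Unique⇒length≤ : ∀ {N} {xs : List (Fin N)} → Unique xs → length xs ≤ N
Unique⇒length≤ {N} {xs} distinct with length xs ≤? N
... | yes fits = fits
... | no overflows with i , j , i<j , same ← pigeonhole (≰⇒> overflows) (lookup xs) =
  ⊥-elim (<⇒≢ i<j (cong toℕ (Unique-tabulate⁻ (lookup xs) (subst Unique (sym (tabulate-lookup xs)) distinct) same)))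

module _ {k r : ℕ} (Q : EdgeSet (Fin (suc (k + r)))) (c̄ : Fin (suc (k + r)))
         (qv : Fin (suc k) → Fin (suc (k + r))) (qv-injective : Injective _≡_ _≡_ qv) (qv∈Q : ∀ j → VS Q (qv j)) where
  open Without (Data.Fin._≟_ {suc (k + r)})

  few-contracted-vertices : ∀ xs → Unique xs → All (ContrVertex Q c̄) xs → length xs ≤ suc r
  few-contracted-vertices xs distinct contracted =
    ≤-trans (length-without c̄ distinct) (s≤s (+-cancelʳ-≤ (suc k) _ _ (begin
      length (xs without c̄) + suc k              ≡⟨ cong (length (xs without c̄) +_) |Q-vertices| ⟨
      length (xs without c̄) + length Q-vertices  ≡⟨ length-++ (xs without c̄) ⟨
      length (xs without c̄ ++ Q-vertices)        ≤⟨ Unique⇒length≤ all-distinct ⟩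
      suc (k + r)                                ≡⟨ cong suc (+-comm k r) ⟩
      suc (r + k)                                ≡⟨ +-suc r k ⟨
      r + suc k                                  ∎)))
    where
      open ≤-Reasoning
      Q-vertices = map qv (allFin (suc k))
      |Q-vertices| : length Q-vertices ≡ suc k
      |Q-vertices| = trans (length-map qv (allFin _)) (length-tabulate id)
      disjoint : ∀ {z} → ¬ (z ∈ xs without c̄ × z ∈ Q-vertices)
      disjoint (z∈xs , z∈Q) with z∈ , z≢c̄ ← ∈-without⁻ c̄ z∈xs with All.lookup contracted z∈ | ∈-map⁻ qv z∈Q
      ... | inj₁ z≡c̄ | _ = z≢c̄ z≡c̄
      ... | inj₂ z∉Q | j , _ , refl = z∉Q (qv∈Q j)
      all-distinct : Unique (xs without c̄ ++ Q-vertices)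
      all-distinct = ++⁺ (Unique-without c̄ distinct) (map⁺ qv-injective (allFin⁺ _)) disjoint

  contracted-saguaro-spans : (P : Fin r → EdgeSet (Fin (suc (k + r)))) → Saguaro (tabulate (λ i → Contr Q c̄ (P i))) →
                             ∀ x → ContrVertex Q c̄ x → VS (⋃L (tabulate (λ i → Contr Q c̄ (P i)))) x
  contracted-saguaro-spans P saguaro = saguaro-spans (ContrVertex Q c̄) saguaro spanned-contracted few
    where
      open Saguaros (Data.Fin._≟_ {suc (k + r)}) using (saguaro-spans)
      G = λ i → Contr Q c̄ (P i)
      spanned-contracted : ∀ z → VS (⋃L (tabulate G)) z → ContrVertex Q c̄ z
      spanned-contracted z q with j , w , e ← VS-⋃L-tabulate⁻ G q = Contr-vertex Q c̄ (Adj-sym {E = G j} e)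
      few : ∀ xs → Unique xs → All (ContrVertex Q c̄) xs → length xs ≤ suc (length (tabulate G))
      few xs distinct contracted =
        subst (λ n → length xs ≤ suc n) (sym (length-tabulate G)) (few-contracted-vertices xs distinct contracted)

module LinkedSet {A : Set} (_≟_ : DecidableEquality A) {k r : ℕ}
  (K : Fin k → EdgeSet A) (L : Fin r → EdgeSet A) (no-rainbow : ¬ RainbowCycle (K ++ᶠ L))
  (Q : EdgeSet A) (V : A → Set) (V⊆Q : ∀ u → V u → VS Q u)
  (linked : ∀ u v → V u → V v → u ≢ v → Σ ℕ λ ℓ → 2 ≤ ℓ × RainbowPathIn K Q ℓ u v) where

  open import Data.List.Membership.DecPropositional _≟_ using (_∈?_)
  open Saguaros _≟_ using (RainbowConnected; RainbowPath; rainbowPath; SubBag-tabulate⁻)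

  private
    linking-walk : ∀ {u v} → V u → V v → u ≢ v →
      ∃₂ λ ts cs → Walk K u v ts cs × Unique (u ∷ ts) × Unique cs × 2 ≤ length ts × All (VS Q) (u ∷ ts)
    linking-walk {u} {v} Vu Vv u≢v with ℓ , 2≤ℓ , path ← linked u v Vu Vv u≢v
      with ts , cs , p , dv , dc , |ts| , in-Q ← RainbowPathIn⇒Walk K L (≤-trans (s≤s z≤n) 2≤ℓ) path =
      ts , cs , p , dv , dc , subst (2 ≤_) (sym |ts|) 2≤ℓ , in-Q

    link : ∀ {u v} → V u → V v → ∃₂ λ ts cs → Walk K u v ts cs × Unique (u ∷ ts) × Unique cs × All (VS Q) (u ∷ ts)
    link {u} {v} Vu Vv with u ≟ v
    ... | yes refl = [] , [] , stop , [] ∷ [] , [] , V⊆Q u Vu ∷ []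
    ... | no u≢v with ts , cs , p , dv , dc , _ , in-Q ← linking-walk Vu Vv u≢v = ts , cs , p , dv , dc , in-Q

  no-L-edge-in-V : ∀ i u v → V u → V v → ¬ Adj (L i) u v
  no-L-edge-in-V i u v Vu Vv e with ts , cs , p , dv , dc , long , _ ← linking-walk Vu Vv (proj₁ e) =
    no-rainbow (K-then-L-cycle K L p stop (subst (λ zs → Unique (u ∷ zs)) (sym (++-identityʳ ts)) dv) dc ([] ∷ [])
                  (Adj-sym {E = L i} e) (subst (λ zs → 2 ≤ length zs) (sym (++-identityʳ ts)) long))

  no-L-cycle : ¬ RainbowClosedWalk L
  no-L-cycle W = no-rainbow (K-then-L-cycle K L stop walk distinct-vertices [] distinct-colours closing-edge long)
    where open RainbowClosedWalk W

  module Contracted (c̄ : A) (c̄∈Q : VS Q c̄) (P : Fin r → EdgeSet A) (P⊆L : ∀ i → P i ⊆ₑ L i)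
                    (P-avoids : ∀ i u → VS (P i) u → VS Q u → V u) where

    G : Fin r → EdgeSet A
    G i = Contr Q c̄ (P i)

    private
      lift-walk : ∀ {a b ts cs} → Walk G a b ts cs → a ≢ c̄ → All (_≢ c̄) ts → Walk L a b ts cs
      lift-walk stop _ _ = stop
      lift-walk (step i e p) a≢ (b≢ ∷ bs≢) = step i (P⊆L i _ _ (Contr-away Q c̄ a≢ b≢ e)) (lift-walk p b≢ bs≢)

      outside-Q : ∀ {a b ts cs} → Walk G a b ts cs → All (_≢ c̄) ts → All (λ z → ¬ VS Q z) ts
      outside-Q stop [] = []
      outside-Q (step i e p) (b≢ ∷ bs≢) with Contr-vertex Q c̄ e
      ... | inj₁ b≡c̄ = ⊥-elim (b≢ b≡c̄)
      ... | inj₂ b∉Q = b∉Q ∷ outside-Q p bs≢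

      through-c̄ : (W : RainbowClosedWalk G) → RainbowClosedWalk.start W ≡ c̄ → ⊥
      through-c̄ record { walk = step {y = t} {ts = ts} c₀ e p ; distinct-vertices = c̄∉ ∷ distinct-inner
                       ; distinct-colours = distinct-colours ; closer = c ; closing-edge = closing ; long = long } refl
        with t≢c̄ ∷ ts≢c̄ ← All-≢-sym c̄∉
        with v₁ , v₁∈Q , e₁ ← Contr-at-c̄ Q c̄ c̄∈Q t≢c̄ e
           | v₂ , v₂∈Q , e₂ ← Contr-at-c̄ Q c̄ c̄∈Q (All.lookup (t≢c̄ ∷ ts≢c̄) (end∈ (step c₀ e p) (s≤s z≤n)))
                                                   (Adj-sym {E = G c} closing)
        with qs , ds , q , distinct-q , distinct-ds , q-in-Q
               ← link (P-avoids c v₂ (_ , e₂) v₂∈Q) (P-avoids c₀ v₁ (_ , e₁) v₁∈Q) =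
        no-rainbow (K-then-L-cycle K L q (step c₀ (P⊆L c₀ _ _ e₁) (lift-walk p t≢c̄ ts≢c̄))
                      (++⁺ distinct-q distinct-inner Q-disjoint) distinct-ds distinct-colours
                      (P⊆L c _ _ (Adj-sym {E = P c} e₂)) (length-++-≥ {m = 0} qs z≤n long))
        where
          Q-disjoint : ∀ {z} → ¬ (z ∈ _ ∷ qs × z ∈ t ∷ ts)
          Q-disjoint (z∈q , z∈inner) = All.lookup (outside-Q (step c₀ e p) (t≢c̄ ∷ ts≢c̄)) z∈inner (All.lookup q-in-Q z∈q)

      avoiding-c̄ : (W : RainbowClosedWalk G) → c̄ ∉ vertices W → ⊥
      avoiding-c̄ W c̄∉ = no-L-cycle record
        { walk              = lift-walk walk (All.head vertices≢c̄) (All.tail vertices≢c̄)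
        ; distinct-vertices = distinct-vertices
        ; distinct-colours  = distinct-colours
        ; closing-edge      = P⊆L closer _ _ (Contr-away Q c̄ end≢c̄ (All.head vertices≢c̄) closing-edge)
        ; long              = long
        }
        where
          open RainbowClosedWalk W
          vertices≢c̄ : All (_≢ c̄) (vertices W)
          vertices≢c̄ = All.tabulate (λ z∈ z≡c̄ → c̄∉ (subst (_∈ vertices W) z≡c̄ z∈))
          end≢c̄ : end ≢ c̄
          end≢c̄ = All.lookup (All.tail vertices≢c̄) (end∈ walk (≤-trans (n≤1+n 1) long))

    no-contracted-rainbow-cycle : ¬ RainbowCycle G
    no-contracted-rainbow-cycle rc with W ← rainbowCycle⇒closedWalk rc with c̄ ∈? vertices W
    ... | yes c̄∈ = let W′ , starts-at-c̄ = rotateTo W c̄∈ in through-c̄ W′ starts-at-c̄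
    ... | no c̄∉ = avoiding-c̄ W c̄∉

  module CommonCycle (c̄ : A) (c̄∈Q : VS Q c̄) (P : Fin r → EdgeSet A) (P⊆L : ∀ i → P i ⊆ₑ L i)
                     (P-avoids : ∀ i u → VS (P i) u → VS Q u → V u)
                     (connected : RainbowConnected (tabulate (λ j → Contr Q c̄ (P j))))
                     (i : Fin r) (cy : Cyc A) (Gᵢ-cycle : IsCycleOn (Contr Q c̄ (P i)) cy)
                     (g : Fin (2 + len cy) → Fin r) (g-injective : Injective _≡_ _≡_ g)
                     (g-copies : ∀ j → (IsCycleOn (Contr Q c̄ (P j)) cy → ∃ λ t → g t ≡ j)
                                     × ((∃ λ t → g t ≡ j) → IsCycleOn (Contr Q c̄ (P j)) cy))
                     {u v : A} (uv∈Lᵢ : Adj (L i) u v) (u∉Q : ¬ VS Q u) (u∉Pᵢ : ¬ VS (P i) u)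
                     (Vv : V v) (v∈Pᵢ : VS (P i) v)
                     (u-spanned : VS (⋃L (tabulate (λ j → Contr Q c̄ (P j)))) u) where

    G : Fin r → EdgeSet A
    G j = Contr Q c̄ (P j)

    -- (b) applies to P⁺ as well, because u ∉ V(Q) and v ∈ V.
    P⁺ : Fin r → EdgeSet A
    P⁺ j a b = P j a b ⊎ (j ≡ i × a ≡ u × b ≡ v)

    G⁺ : Fin r → EdgeSet A
    G⁺ j = Contr Q c̄ (P⁺ j)

    private
      open CyclicShift {2 + len cy}

      P⁺⊆L : ∀ j → P⁺ j ⊆ₑ L j
      P⁺⊆L j a b (a≢b , inj₁ (inj₁ e)) = P⊆L j a b (a≢b , inj₁ e)
      P⁺⊆L j a b (a≢b , inj₂ (inj₁ e)) = P⊆L j a b (a≢b , inj₂ e)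
      P⁺⊆L j a b (a≢b , inj₁ (inj₂ (refl , refl , refl))) = uv∈Lᵢ
      P⁺⊆L j a b (a≢b , inj₂ (inj₂ (refl , refl , refl))) = Adj-sym {E = L i} uv∈Lᵢ

      P⁺-avoids : ∀ j a → VS (P⁺ j) a → VS Q a → V a
      P⁺-avoids j a (b , a≢b , inj₁ (inj₁ e)) = P-avoids j a (b , a≢b , inj₁ e)
      P⁺-avoids j a (b , a≢b , inj₂ (inj₁ e)) = P-avoids j a (b , a≢b , inj₂ e)
      P⁺-avoids j a (b , a≢b , inj₁ (inj₂ (refl , refl , refl))) a∈Q = ⊥-elim (u∉Q a∈Q)
      P⁺-avoids j a (b , a≢b , inj₂ (inj₂ (refl , refl , refl))) _ = Vv

      G⊆G⁺ : ∀ j {a b} → Adj (G j) a b → Adj (G⁺ j) a b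
      G⊆G⁺ j = Contr-mono λ where
        (a≢b , inj₁ e) → a≢b , inj₁ (inj₁ e)
        (a≢b , inj₂ e) → a≢b , inj₂ (inj₁ e)

      Walk-G⊆G⁺ : ∀ {a b ts js} → Walk G a b ts js → Walk G⁺ a b ts js
      Walk-G⊆G⁺ stop = stop
      Walk-G⊆G⁺ (step j e p) = step j (G⊆G⁺ j e) (Walk-G⊆G⁺ p)

      module Enlarged = Contracted c̄ c̄∈Q P⁺ P⁺⊆L P⁺-avoids

      tᵢ : Fin (2 + len cy)
      tᵢ = proj₁ (proj₁ (g-copies i) Gᵢ-cycle)

      Copy : Fin r → Set
      Copy j = j ≢ i × IsCycleOn (G j) cy

      copies : List (Fin r)
      copies = map (λ t → g (punchIn tᵢ t)) (allFin (suc (len cy)))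

      copies-unique : Unique copies
      copies-unique = map⁺ (λ e → punchIn-injective tᵢ _ _ (g-injective e)) (allFin⁺ _)

      copies-copy : All Copy copies
      copies-copy = All.map⁺ (All.tabulate⁺ λ t →
        (λ e → punchInᵢ≢i tᵢ t (g-injective (trans e (sym (proj₂ (proj₁ (g-copies i) Gᵢ-cycle)))))) ,
        proj₂ (g-copies _) (_ , refl))

      length-copies : length copies ≡ suc (len cy)
      length-copies = trans (length-map (λ t → g (punchIn tᵢ t)) (allFin _)) (length-tabulate id)

      copy-carries : ∀ {j} → Copy j → Carries cy {F = G⁺} j
      copy-carries (_ , G-cycle) p = G⊆G⁺ _ (proj₂ (G-cycle _ _) (p , inj₁ (refl , refl)))

      on-cycle : List A
      on-cycle = tabulate (vs cy)

      position : ∀ {z} → z ∈ on-cycle → ∃ λ p → vs cy p ≡ z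
      position z∈ with p , z≡ ← ∈-tabulate⁻ z∈ = p , sym z≡

      cycle-vertex : ∀ {j a b} → IsCycleOn (G j) cy → Adj (G j) a b → a ∈ on-cycle
      cycle-vertex G-cycle e with proj₁ (G-cycle _ _) e
      ... | p , inj₁ (refl , _) = ∈-tabulate⁺ {f = vs cy} p
      ... | p , inj₂ (_ , refl) = ∈-tabulate⁺ {f = vs cy} (csuc p)

      u≢c̄ : u ≢ c̄
      u≢c̄ u≡c̄ = u∉Q (subst (VS Q) (sym u≡c̄) c̄∈Q)

      u-off-cycle : u ∉ on-cycle
      u-off-cycle u∈ with p , refl ← position u∈ =
        u∉Pᵢ (Contr-spanned Q c̄ (proj₂ (Gᵢ-cycle _ _) (p , inj₁ (refl , refl))) u≢c̄)

      c̄-edge : ∀ {y} → Adj (P i) v y → Adj (G i) c̄ y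
      c̄-edge {y} v-y = c̄≢y , inj₁ (c̄≢y , v , y , v-y , inj₁ (V⊆Q v Vv , refl) , inj₂ (y∉Q , refl))
        where
          y∉Q : ¬ VS Q y
          y∉Q y∈Q = no-L-edge-in-V i v y Vv (P-avoids i y (v , Adj-sym {E = P i} v-y) y∈Q) (P⊆L i v y v-y)
          c̄≢y : c̄ ≢ y
          c̄≢y c̄≡y = y∉Q (subst (VS Q) c̄≡y c̄∈Q)

      c̄-on-cycle : c̄ ∈ on-cycle
      c̄-on-cycle = cycle-vertex Gᵢ-cycle (c̄-edge (proj₂ v∈Pᵢ))

      closing : Adj (G⁺ i) c̄ u
      closing = u≢c̄ ∘ sym , inj₂ (u≢c̄ , u , v , (proj₁ uv∈Lᵢ , inj₁ (inj₂ (refl , refl , refl))) ,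
                                  inj₂ (u∉Q , refl) , inj₁ (V⊆Q v Vv , refl))

      record FirstHit (a : A) (ts : List A) (js : List (Fin r)) : Set where
        field
          hit        : A
          before     : List A
          colours₁   : List (Fin r)
          walk₁      : Walk G a hit (before ++ [ hit ]) colours₁
          hit-on     : hit ∈ on-cycle
          off-before : All (_∉ on-cycle) (a ∷ before)
          ts-prefix  : ∃ λ rest → ts ≡ before ++ hit ∷ rest
          js-prefix  : ∃ λ rest → js ≡ colours₁ ++ rest
          no-copies  : All (λ j → ¬ IsCycleOn (G j) cy) colours₁

      firstHit : ∀ {a b ts js} → Walk G a b ts js → a ∉ on-cycle → b ∈ on-cycle → FirstHit a ts js
      firstHit stop a∉ b∈ = ⊥-elim (a∉ b∈)
      firstHit (step {y = y} j e p) a∉ b∈ with y ∈? on-cycle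
      ... | yes y∈ = record
        { walk₁ = step j e stop ; hit-on = y∈ ; off-before = a∉ ∷ [] ; ts-prefix = _ , refl ; js-prefix = _ , refl
        ; no-copies = (λ G-cycle → a∉ (cycle-vertex G-cycle e)) ∷ [] }
      ... | no y∉ = record
        { walk₁ = step j e walk₁ ; hit-on = hit-on ; off-before = a∉ ∷ off-before
        ; ts-prefix = _ , cong (y ∷_) (proj₂ ts-prefix) ; js-prefix = _ , cong (j ∷_) (proj₂ js-prefix)
        ; no-copies = (λ G-cycle → a∉ (cycle-vertex G-cycle e)) ∷ no-copies }
        where open FirstHit (firstHit p y∉ b∈)

      record ArcTo (w : A) : Set where
        field
          arc-ts       : List A
          arc-cs       : List (Fin r)
          arc-walk     : Walk G⁺ w c̄ arc-ts arc-cs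
          arc-vertices-distinct : Unique (w ∷ arc-ts)
          arc-on-cycle : All (_∈ on-cycle) arc-ts
          arc-colours-distinct : Unique arc-cs
          arc-copies   : All Copy arc-cs

      trivialArc : ∀ {w} → w ≡ c̄ → ArcTo w
      trivialArc refl = record
        { arc-walk = stop ; arc-vertices-distinct = [] ∷ [] ; arc-on-cycle = [] ; arc-colours-distinct = [] ; arc-copies = [] }

      arcTo : ∀ {w} → w ∈ on-cycle → w ≢ c̄ → Σ (ArcTo w) λ α → 1 ≤ length (ArcTo.arc-ts α)
      arcTo w∈ w≢c̄ with pw , refl ← position w∈ | pc , refl ← position c̄-on-cycle
        with csuc^-reaches pw pc (w≢c̄ ∘ cong (vs cy))
      ... | d , 0<d , d≤m , w→c̄ with d ≤? suc (len cy)
      ... | yes d≤copies = record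
        { arc-walk     = subst (λ z → Walk G⁺ (vs cy pw) z (arcVertices cy pw (length (take d copies))) (take d copies))
                               (cong (vs cy) (trans (cong (λ t → csuc^ t pw) |taken|) w→c̄))
                               (arc cy pw (All.take⁺ d (All.map copy-carries copies-copy)))
        ; arc-vertices-distinct = arc-unique cy pw _ (subst (_≤ 2 + len cy) (sym |taken|) d≤m)
        ; arc-on-cycle = All.tabulate (λ z∈ → case ∈-applyUpTo⁻ _ z∈ of λ (_ , _ , z≡) →
                           subst (_∈ on-cycle) (sym z≡) (∈-tabulate⁺ {f = vs cy} _))
        ; arc-colours-distinct = Unique-take⁺ d copies-unique
        ; arc-copies   = All.take⁺ d copies-copy
        } , subst (1 ≤_) (sym (trans (length-applyUpTo _ _) |taken|)) 0<d
        where
          |taken| : length (take d copies) ≡ d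
          |taken| = trans (length-take d copies) (m≤n⇒m⊓n≡m (subst (d ≤_) (sym length-copies) d≤copies))
      -- c̄ immediately precedes w on the cycle.
      ... | no d≰copies = record
        { arc-walk              = step j₀ (Adj-sym {E = G⁺ j₀} c̄-w) stop
        ; arc-vertices-distinct = (w≢c̄ ∷ []) ∷ [] ∷ []
        ; arc-on-cycle          = c̄-on-cycle ∷ []
        ; arc-colours-distinct  = [] ∷ []
        ; arc-copies            = All.head copies-copy ∷ []
        } , s≤s z≤n
        where
          j₀ = g (punchIn tᵢ zero)
          c̄-follows-w : csuc pc ≡ pw
          c̄-follows-w = begin
            csuc pc                 ≡⟨ cong csuc w→c̄ ⟨
            csuc (csuc^ d pw)       ≡⟨ csuc^-csuc d pw ⟨
            csuc^ (suc d) pw        ≡⟨ cong (λ t → csuc^ (suc t) pw) (≤-antisym d≤m (≰⇒> d≰copies)) ⟩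
            csuc^ (3 + len cy) pw   ≡⟨ csuc^-period pw ⟩
            pw                      ∎
            where open ≡-Reasoning
          c̄-w : Adj (G⁺ j₀) (vs cy pc) (vs cy pw)
          c̄-w = subst (λ p → Adj (G⁺ j₀) (vs cy pc) (vs cy p)) c̄-follows-w (copy-carries (All.head copies-copy) pc)

      assemble : ∀ {ts js} → Unique (u ∷ ts) → Unique js → (H : FirstHit u ts js) (α : ArcTo (FirstHit.hit H)) →
                 2 ≤ length ((FirstHit.before H ++ [ FirstHit.hit H ]) ++ ArcTo.arc-ts α) → RainbowClosedWalk G⁺
      assemble distinct-ts distinct-js H α long = record
        { walk              = Walk-G⊆G⁺ walk₁ ++ᵂ arc-walk
        ; distinct-vertices = subst (λ zs → Unique (u ∷ zs)) (sym (++-assoc before [ hit ] arc-ts))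
                                (++⁺ before-distinct arc-vertices-distinct off-meets-on)
        ; distinct-colours  = All.++⁺ (All.map (λ not-copy i≡j → not-copy (subst (λ j → IsCycleOn (G j) cy) i≡j Gᵢ-cycle))
                                               no-copies)
                                      (All.map (λ copy i≡j → proj₁ copy (sym i≡j)) arc-copies)
                              ∷ ++⁺ colours₁-distinct arc-colours-distinct
                                    (λ (j∈₁ , j∈₂) → All.lookup no-copies j∈₁ (proj₂ (All.lookup arc-copies j∈₂)))
        ; closing-edge      = closing
        ; long              = long
        }
        where
          open FirstHit H
          open ArcTo α
          before-distinct : Unique (u ∷ before)
          before-distinct = Unique-++⁻ˡ (u ∷ before) (subst (λ zs → Unique (u ∷ zs)) (proj₂ ts-prefix) distinct-ts)
          colours₁-distinct : Unique colours₁
          colours₁-distinct = Unique-++⁻ˡ colours₁ (subst Unique (proj₂ js-prefix) distinct-js)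
          off-meets-on : ∀ {z} → ¬ (z ∈ u ∷ before × z ∈ hit ∷ arc-ts)
          off-meets-on (z∈₁ , z∈₂) = All.lookup off-before z∈₁ (All.lookup (hit-on ∷ arc-on-cycle) z∈₂)

      revisits : ∀ {a b z rest js} → Walk G a b (z ∷ rest) js → z ≡ b → 1 ≤ length rest → ¬ Unique (z ∷ rest)
      revisits (step _ _ p) refl = no-return p

      before-nonempty : ∀ {ts js} → Walk G u c̄ ts js → 2 ≤ length ts → Unique (u ∷ ts) → (H : FirstHit u ts js) →
                        FirstHit.hit H ≡ c̄ → 1 ≤ length (FirstHit.before H)
      before-nonempty p long (_ ∷ distinct) H hit≡c̄ with FirstHit.before H | FirstHit.ts-prefix H
      ... | _ ∷ _ | _ = s≤s z≤n
      ... | [] | _ , ts≡ with s≤s long′ ← subst (λ zs → 2 ≤ length zs) ts≡ long =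
        ⊥-elim (revisits (subst (λ zs → Walk G u c̄ zs _) ts≡ p) hit≡c̄ long′ (subst Unique ts≡ distinct))

    escaping-edge-impossible : ⊥
    escaping-edge-impossible
      with rainbowPath ts cs walk distinct sub _ , long
             ← connected u c̄ u-spanned (VS-⋃L⁺ (∈-tabulate⁺ i) (_ , c̄-edge (proj₂ v∈Pᵢ))) u≢c̄
      with js , distinct-js , refl ← SubBag-tabulate⁻ G sub
      with H ← firstHit (comapᵂ G js walk) u-off-cycle c̄-on-cycle
      with FirstHit.hit H ≟ c̄
    ... | no hit≢c̄ with α , nonempty ← arcTo (FirstHit.hit-on H) hit≢c̄ =
      Enlarged.no-contracted-rainbow-cycle (closedWalk⇒rainbowCycle (assemble distinct distinct-js H α
        (length-++-≥ {m = 1} (FirstHit.before H ++ _) (length-++-≥ {m = 0} (FirstHit.before H) z≤n (s≤s z≤n)) nonempty)))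
    ... | yes hit≡c̄ =
      Enlarged.no-contracted-rainbow-cycle (closedWalk⇒rainbowCycle (assemble distinct distinct-js H (trivialArc hit≡c̄)
        (length-++-≥ {n = 0} (FirstHit.before H ++ _)
          (length-++-≥ {m = 1} (FirstHit.before H) (before-nonempty (comapᵂ G js walk) long distinct H hit≡c̄) (s≤s z≤n))
          z≤n)))

lemma3p6 : (k r : ℕ) → 0 < r →
    (K : Fin k → EdgeSet (Fin (suc (k + r)))) →
    (L : Fin r → EdgeSet (Fin (suc (k + r)))) →
    (∀ i → IsCycle ((K ++ᶠ L) i)) →
    ¬ RainbowCycle (K ++ᶠ L) →
    (Q : EdgeSet (Fin (suc (k + r)))) →
    Q ⊆ₑ ⋃F K →
    (qv : Fin (suc k) → Fin (suc (k + r))) → Injective _≡_ _≡_ qv →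
    (∀ u → (VS Q u → ∃ λ j → qv j ≡ u) × ((∃ λ j → qv j ≡ u) → VS Q u)) →
    (V : Fin (suc (k + r)) → Set) →
    (∀ u → V u → VS Q u) →
    (∀ u v → V u → V v → u ≢ v → Σ ℕ λ ℓ → 2 ≤ ℓ × RainbowPathIn K Q ℓ u v) →
    -- (a)
    (∀ i u v → V u → V v → ¬ Adj (L i) u v)
    ×
    (∀ (c̄ : Fin (suc (k + r))) → VS Q c̄ →
     (P : Fin r → EdgeSet (Fin (suc (k + r)))) →
     (∀ i → P i ⊆ₑ L i) →
     (∀ i u → VS (P i) u → VS Q u → V u) →
     -- (b)
     ¬ RainbowCycle (λ i → Contr Q c̄ (P i))
     ×
     -- (c)
     (Saguaro (tabulate (λ i → Contr Q c̄ (P i))) →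
       (∀ x → ContrVertex Q c̄ x → VS (⋃F (λ i → Contr Q c̄ (P i))) x)
       ×
       (∀ i → Common (λ j → Contr Q c̄ (P j)) i →
          ¬ (∃ λ u → ∃ λ v → Adj (L i) u v × ¬ Adj (P i) u v ×
                ¬ VS Q u × ¬ VS (P i) u × V v × VS (P i) v))))
lemma3p6 k r _ K L _ no-rainbow Q _ qv qv-injective qv-spans-Q V V⊆Q linked =
  no-L-edge-in-V , λ c̄ c̄∈Q P P⊆L P-avoids →
    Contracted.no-contracted-rainbow-cycle c̄ c̄∈Q P P⊆L P-avoids ,
    λ saguaro → let spans = contracted-saguaro-spans Q c̄ qv qv-injective qv∈Q P saguaro in
      (λ x x-vertex → VS-⋃F⁺ {G = λ i → Contr Q c̄ (P i)} (proj₂ (VS-⋃L-tabulate⁻ _ (spans x x-vertex)))) ,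
      λ { i (cy , Gᵢ-cycle , g , g-injective , g-copies) (u , v , uv∈Lᵢ , _ , u∉Q , u∉Pᵢ , Vv , v∈Pᵢ) →
          CommonCycle.escaping-edge-impossible c̄ c̄∈Q P P⊆L P-avoids (saguaro-connected saguaro)
            i cy Gᵢ-cycle g g-injective g-copies uv∈Lᵢ u∉Q u∉Pᵢ Vv v∈Pᵢ (spans u (inj₂ u∉Q)) }
  where
    open LinkedSet Data.Fin._≟_ K L no-rainbow Q V V⊆Q linked
    open Saguaros (Data.Fin._≟_ {suc (k + r)}) using (saguaro-connected)
    qv∈Q : ∀ j → VS Q (qv j)
    qv∈Q j = proj₂ (qv-spans-Q (qv j)) (j , refl)
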